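{- Let $(T,I,J)$ be a gluing tree, let $j\in J$ with $N_T(j)=\{i,k\}$, and let $X$ be the tree obtained from $T$ by replacing the path $i-j-k$ with the single edge $i-k$, so that $(X,I,J\setminus\{j\})$ is a gluing tree. Then, after the relabeling of coordinates described below, the coordinate projection forgetting the coordinates $x_{ijj'}$ and $x_{jj'k}$ maps $\mathrm{CIM}_T^{I,J}$ onto $\mathrm{CIM}_X^{I,J\setminus\{j\}}$.
   Context: A gluing tree $(T,I,J)$ is a tree $T$ with disjoint node sets $I,J$ such that no two nodes of $I\cup J$ are adjacent, every node of $I$ is a leaf of $T$ and every node of $J$ has degree two in $T$. For a DAG $\mathcal{T}$ with skeleton $T$, $\mathcal{T}^{I\cup J}$ is obtained by adding a new node $v'$ and an edge $v'\to v$ for each $v\in I\cup J$. For a DAG $\mathcal{D}$ on a finite set $V$ and $A\subseteq V$, $c_{\mathcal{D}}(A)=1$ if some $a\in A$ has every $b\in A\setminus\{a\}$ as a parent in $\mathcal{D}$, and $0$ otherwise. $\mathrm{CIM}_T^{I,J}=\mathrm{conv}\{c_{\mathcal{T}^{I\cup J}}:\mathcal{T}\text{ a DAG with skeleton }T\text{ such that for all }j\in J\text{ with }N_T(j)=\{i,k\},\ i\to j\to k\text{ or }i\leftarrow j\leftarrow k\text{ in }\mathcal{T}\}$, regarded in the coordinates $x_A$ with $A$ the vertex set of a star subgraph (a center vertex with at least two of its neighbours) of $T$ with the edges $v'\to v$ added, omitting for each $j\in J$ with $N_T(j)=\{i,k\}$ the sets $\{i,j,k\},\{i,j,j',k\}$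 (zero on the polytope); other coordinates are constant. Relabeling: for each coordinate $x_A$ of $\mathrm{CIM}_T^{I,J}$ whose set $A$ is the vertex set of a star with center $\ell\ne j$: if $j\notin A$ keep $x_A$; if $\ell=i$ and $j\in A$, rename $x_A$ to $x_{(A\cup\{k\})\setminus\{j\}}$; if $\ell=k$ and $j\in A$, rename $x_A$ to $x_{(A\cup\{i\})\setminus\{j\}}$. The coordinates $x_{ijj'},x_{jj'k}$ (stars centered at $j$) are not relabeled.
   Formalization: Both $\mathrm{CIM}_T^{I,J}$ and $\mathrm{CIM}_X^{I,J\setminus\{j\}}$ are taken over ℚ: their points have rational coordinates and are convex combinations of characteristic imsets with rational weights. -}

module Defs where

open import Data.Bool using (Bool; true; false; T; _∨_; _∧_; if_then_else_)
open import Data.Nat using (ℕ; suc; _≤_; _+_)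
open import Data.Fin using (Fin; punchIn; _≟_)
open import Data.Fin.Subset using (Subset; _∈_; _∉_; ⁅_⁆; _∪_; ∣_∣; inside)
  renaming (⊥ to ∅)
open import Data.Vec using (Vec; lookup; removeAt; _[_]≔_)
open import Data.List using (List; []; _∷_; [_]; _++_; length; foldr)
open import Data.List.Relation.Unary.All using (All)
open import Data.List.Relation.Unary.Linked using (Linked)
open import Data.List.Relation.Unary.Unique.Propositional using (Unique)
open import Data.Product using (Σ; _×_; _,_; proj₁; proj₂; ∃; ∃-syntax)
open import Data.Sum using (_⊎_; inj₁; inj₂)
open import Data.Empty using (⊥)
open import Data.Rational using (ℚ; 0ℚ; 1ℚ) renaming (_≤_ to _≤ℚ_; _+_ to _+ℚ_; _*_ to _*ℚ_)
open import Relation.Nullary using (¬_)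
open import Relation.Nullary.Decidable using (⌊_⌋)
open import Relation.Binary.PropositionalEquality using (_≡_; _≢_)
open import Relation.Binary.Construct.Closure.Transitive using (TransClosure)
open import Relation.Binary.Construct.Closure.ReflexiveTransitive using (Star)

record Graph (m : ℕ) : Set where
  field
    adj     : Fin m → Fin m → Bool
    adj-sym : ∀ u v → T (adj u v) → T (adj v u)
    adj-irr : ∀ v → ¬ T (adj v v)
open Graph public

Adj : ∀ {m} → Graph m → Fin m → Fin m → Set
Adj G u v = T (adj G u v)

Connected : ∀ {m} → Graph m → Set
Connected G = ∀ u v → Star (Adj G) u v

IsCycle : ∀ {m} → Graph m → List (Fin m) → Set
IsCycle G [] = ⊥
IsCycle G (v ∷ vs) =
  Unique (v ∷ vs) × (3 ≤ length (v ∷ vs)) × Linked (Adj G) (v ∷ vs ++ [ v ])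

IsTree : ∀ {m} → Graph m → Set
IsTree G = Connected G × (∀ cs → ¬ IsCycle G cs)

IsLeaf : ∀ {m} → Graph m → Fin m → Set
IsLeaf G v = Σ _ λ u → Adj G u v × (∀ l → Adj G l v → l ≡ u)

HasDegreeTwo : ∀ {m} → Graph m → Fin m → Set
HasDegreeTwo G v = Σ _ λ u → Σ _ λ w → u ≢ w × Adj G u v × Adj G w v
  × (∀ l → Adj G l v → l ≡ u ⊎ l ≡ w)

Nbhd2 : ∀ {m} → Graph m → Fin m → Fin m → Fin m → Set
Nbhd2 G j i k = i ≢ k × Adj G i j × Adj G k j × (∀ l → Adj G l j → l ≡ i ⊎ l ≡ k)

record GluingTree (m : ℕ) : Set where
  field
    tree    : Graph m
    isTree  : IsTree tree
    I J     : Subset m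
    disj    : ∀ v → v ∈ I → v ∉ J
    nonadj  : ∀ u v → (u ∈ I ⊎ u ∈ J) → (v ∈ I ⊎ v ∈ J) → ¬ Adj tree u v
    I-leaf  : ∀ v → v ∈ I → IsLeaf tree v
    J-deg2  : ∀ v → v ∈ J → HasDegreeTwo tree v

-- Augmented vertex set: inj₁ v is the vertex v, inj₂ v is the new node v'
-- (present / adjacent to anything only when v ∈ I ∪ J; otherwise isolated,
-- hence never in a star and irrelevant).

Aug : ℕ → Set
Aug m = Fin m ⊎ Fin m

-- subsets of the augmented vertex set: (unprimed part , primed part)
Sub : ℕ → Set
Sub m = Subset m × Subset m

_∈A_ : ∀ {m} → Aug m → Sub m → Set
inj₁ v ∈A A = v ∈ proj₁ A
inj₂ v ∈A A = v ∈ proj₂ A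

card : ∀ {m} → Sub m → ℕ
card A = ∣ proj₁ A ∣ + ∣ proj₂ A ∣

InIJ : ∀ {m} → Subset m → Subset m → Fin m → Set
InIJ I J v = v ∈ I ⊎ v ∈ J

AugAdj : ∀ {m} → (Fin m → Fin m → Bool) → Subset m → Subset m → Aug m → Aug m → Set
AugAdj adj I J (inj₁ u) (inj₁ v) = T (adj u v)
AugAdj adj I J (inj₁ u) (inj₂ v) = u ≡ v × InIJ I J v
AugAdj adj I J (inj₂ u) (inj₁ v) = u ≡ v × InIJ I J u
AugAdj adj I J (inj₂ u) (inj₂ v) = ⊥

IsStar : ∀ {m} → (Fin m → Fin m → Bool) → Subset m → Subset m → Sub m → Set
IsStar adj I J A = Σ (Aug _) λ c → c ∈A A
  × (∀ a → a ∈A A → a ≢ c → AugAdj adj I J c a) × (3 ≤ card A)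

Omitted : ∀ {m} → (Fin m → Fin m → Bool) → Subset m → Subset m → Sub m → Set
Omitted adj I J A = Σ _ λ j → j ∈ J × Σ _ λ i → Σ _ λ k →
  (i ≢ k × T (adj i j) × T (adj k j) × (∀ l → T (adj l j) → l ≡ i ⊎ l ≡ k))
  × (A ≡ (⁅ i ⁆ ∪ ⁅ j ⁆ ∪ ⁅ k ⁆ , ∅) ⊎ A ≡ (⁅ i ⁆ ∪ ⁅ j ⁆ ∪ ⁅ k ⁆ , ⁅ j ⁆))

Coord : ∀ {m} → (Fin m → Fin m → Bool) → Subset m → Subset m → Sub m → Set
Coord adj I J A = IsStar adj I J A × ¬ Omitted adj I J A

Arc : ∀ {m} → (Fin m → Fin m → Bool) → Fin m → Fin m → Set
Arc D u v = T (D u v)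

IsDAGWithSkeleton : ∀ {m} → (Fin m → Fin m → Bool) → (Fin m → Fin m → Bool) → Set
IsDAGWithSkeleton adj D =
  (∀ u v → Arc D u v → T (adj u v))
  × (∀ u v → T (adj u v) → Arc D u v ⊎ Arc D v u)
  × (∀ v → ¬ TransClosure (Arc D) v v)

Admissible : ∀ {m} → (Fin m → Fin m → Bool) → Subset m → (Fin m → Fin m → Bool) → Set
Admissible adj J D = IsDAGWithSkeleton adj D
  × (∀ j → j ∈ J → ∀ i k → i ≢ k → T (adj i j) → T (adj k j) →
       (Arc D i j × Arc D j k) ⊎ (Arc D k j × Arc D j i))

AugPar : ∀ {m} → Subset m → Subset m → (Fin m → Fin m → Bool) → Aug m → Aug m → Set
AugPar I J D (inj₁ u) (inj₁ v) = Arc D u v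
AugPar I J D (inj₂ u) (inj₁ v) = u ≡ v × InIJ I J u
AugPar I J D (inj₁ u) (inj₂ v) = ⊥
AugPar I J D (inj₂ u) (inj₂ v) = ⊥

CCond : ∀ {m} → Subset m → Subset m → (Fin m → Fin m → Bool) → Sub m → Set
CCond I J D A = Σ (Aug _) λ a → a ∈A A × (∀ b → b ∈A A → b ≢ a → AugPar I J D b a)

IsImset : ∀ {m} → Subset m → Subset m → (Fin m → Fin m → Bool) → (Sub m → ℚ) → Set
IsImset I J D c = ∀ A → (CCond I J D A → c A ≡ 1ℚ) × (¬ CCond I J D A → c A ≡ 0ℚ)

-- CIM_T^{I,J}: points x (only the values on coordinates matter) that are
-- convex combinations of admissible characteristic imsets.

Vertex : ∀ {m} → (Fin m → Fin m → Bool) → Subset m → Subset m → (Sub m → ℚ) → Set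
Vertex adj I J c = Σ (Fin _ → Fin _ → Bool) λ D → Admissible adj J D × IsImset I J D c

wsum : ∀ {m} → List (ℚ × (Sub m → ℚ)) → Sub m → ℚ
wsum L A = foldr (λ p s → (proj₁ p *ℚ proj₂ p A) +ℚ s) 0ℚ L

weightSum : ∀ {m} → List (ℚ × (Sub m → ℚ)) → ℚ
weightSum L = foldr (λ p s → proj₁ p +ℚ s) 0ℚ L

InCIM : ∀ {m} → (Fin m → Fin m → Bool) → Subset m → Subset m → (Sub m → ℚ) → Set
InCIM adj I J x = Σ (List (ℚ × (Sub _ → ℚ))) λ L →
  All (λ p → (0ℚ ≤ℚ proj₁ p) × Vertex adj I J (proj₂ p)) L
  × weightSum L ≡ 1ℚ
  × (∀ A → Coord adj I J A → x A ≡ wsum L A)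

-- Contraction of i - j - k to i - k.  Vertices of X are Fin n, where
-- u : Fin n stands for punchIn j u : Fin (suc n).

Xadj : ∀ {n} → (Fin (suc n) → Fin (suc n) → Bool) → (j i k : Fin (suc n)) →
       Fin n → Fin n → Bool
Xadj adj j i k u v =
  adj (punchIn j u) (punchIn j v)
  ∨ (⌊ punchIn j u ≟ i ⌋ ∧ ⌊ punchIn j v ≟ k ⌋)
  ∨ (⌊ punchIn j u ≟ k ⌋ ∧ ⌊ punchIn j v ≟ i ⌋)

-- the relabeling (followed by deletion of the vertex j, j'):
-- if j ∈ A (star centred at i resp. k, containing exactly one of i,k)
-- replace j by the other of i,k, i.e. add both i and k; else keep A.
relabel : ∀ {n} → (j i k : Fin (suc n)) → Sub (suc n) → Sub n
relabel j i k (A₁ , A₂) =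
  (if lookup A₁ j
     then removeAt ((A₁ [ i ]≔ inside) [ k ]≔ inside) j
     else removeAt A₁ j)
  , removeAt A₂ j

Kept : ∀ {n} → (adj : Fin (suc n) → Fin (suc n) → Bool) → (I J : Subset (suc n)) →
       (j i k : Fin (suc n)) → Sub (suc n) → Set
Kept adj I J j i k A = Coord adj I J A
  × A ≢ (⁅ i ⁆ ∪ ⁅ j ⁆ , ⁅ j ⁆) × A ≢ (⁅ j ⁆ ∪ ⁅ k ⁆ , ⁅ j ⁆)

{-# OPTIONS --safe #-}
module Submission where

-- Relabelling maps the kept coordinates of T onto the coordinates of X: a kept star either
-- avoids j, or is centred at i or k and contains j but not the other endpoint, and is then sent
-- to a star of X through the new edge i – k. Admissible orientations of T and X correspond: the
-- path i – j – k, directed by admissibility, is replaced by the edge i – k directed the same way,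
-- and conversely. Both augmented graphs are triangle-free (in the tree, j is the only common
-- neighbour of i and k), so c(A) = 1 for a star A exactly when its centre is a sink; hence the
-- characteristic imsets of corresponding orientations agree under the relabelling, and the
-- projection maps vertices to vertices and convex combinations to convex combinations.

open import Defs
open import Data.Bool using (Bool; true; false; T; _∨_; _∧_)
open import Data.Bool.Properties using (T?; T-∨; T-∧)
open import Data.Nat using (ℕ; zero; suc; _≤_; _+_; z≤n; s≤s)
open import Data.Nat.Properties
  using (≤-refl; ≤-trans; ≤-reflexive; m≤m+n; n≤1+n; +-mono-≤; +-suc; module ≤-Reasoning)
open import Data.Fin using (Fin; zero; suc; punchIn; punchOut; _≟_)
open import Data.Fin.Properties using (punchIn-injective; punchInᵢ≢i; punchIn-punchOut; any?; all?)
open import Data.Fin.Subset using (Subset; _∈_; _∉_; _⊆_; ⁅_⁆; _∪_; ∣_∣; inside; outside; Nonempty)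
  renaming (⊥ to ∅)
open import Data.Fin.Subset.Properties
  using (_∈?_; nonempty?; Empty-unique; ∣⊥∣≡0; ⊆-antisym; x∈⁅x⁆; x∈⁅y⁆⇒x≡y; x∈p∪q⁻; x∈p∪q⁺)
open import Data.Vec using (Vec; []; _∷_; there; lookup; removeAt; insertAt; _[_]≔_)
open import Data.Vec.Properties
  using ([]=⇒lookup; lookup⇒[]=; lookup∘update; lookup∘update′;
         insertAt-punchIn; insertAt-lookup; removeAt-insertAt; insertAt-removeAt)
open import Data.Product using (Σ; ∃; _×_; _,_; proj₁; proj₂)
import Data.Product as Product
open import Data.Sum using (_⊎_; inj₁; inj₂; [_,_]′)
import Data.Sum as Sum
open import Data.Sum.Properties using (inj₁-injective; inj₂-injective; ≡-dec)
open import Data.Rational using (ℚ; 0ℚ; 1ℚ) renaming (_≤_ to _≤ℚ_; _+_ to _+ℚ_; _*_ to _*ℚ_)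
open import Data.List using (List; []; _∷_)
open import Data.List.Relation.Unary.All using (All; []; _∷_)
open import Data.List.Relation.Unary.Linked using ([-]; _∷_)
open import Data.List.Relation.Unary.AllPairs using ([]; _∷_)
open import Data.Empty using (⊥; ⊥-elim)
open import Function using (id; _∘_)
open import Function.Bundles using (Equivalence; _⇔_; mk⇔)
open import Function.Construct.Composition using (_⇔-∘_)
open import Function.Construct.Symmetry using (⇔-sym)
open import Relation.Nullary using (¬_; Dec; yes; no)
open import Relation.Nullary.Decidable using (⌊_⌋; map′; _×-dec_; _⊎-dec_; _→-dec_; ¬?; toWitness; fromWitness)
open import Relation.Binary.PropositionalEquality
  using (_≡_; _≢_; refl; sym; trans; cong; cong₂; subst; subst₂; module ≡-Reasoning)
open import Relation.Binary.Construct.Closure.Transitive using (TransClosure; _∷_; _++_)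
  renaming ([_] to ⟪_⟫)

open Equivalence using (to; from)

private
  variable
    m : ℕ

lookup-removeAt : ∀ {A : Set} {n} (xs : Vec A (suc n)) (j : Fin (suc n)) (u : Fin n) →
                  lookup (removeAt xs j) u ≡ lookup xs (punchIn j u)
lookup-removeAt (x ∷ xs)     zero    u       = refl
lookup-removeAt (x ∷ y ∷ xs) (suc j) zero    = refl
lookup-removeAt (x ∷ y ∷ xs) (suc j) (suc u) = lookup-removeAt (y ∷ xs) j u

lookup⇒∈ : ∀ {p : Subset m} {x} → lookup p x ≡ inside → x ∈ p
lookup⇒∈ {p = p} {x} = lookup⇒[]= x p

infixl 5 _∖_

_∖_ : Subset m → Fin m → Subset m
p ∖ x = p [ x ]≔ outside

∣p∣≤1+∣p∖x∣ : ∀ (p : Subset m) x → ∣ p ∣ ≤ suc ∣ p ∖ x ∣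
∣p∣≤1+∣p∖x∣ (inside  ∷ p) zero    = ≤-refl
∣p∣≤1+∣p∖x∣ (outside ∷ p) zero    = n≤1+n _
∣p∣≤1+∣p∖x∣ (inside  ∷ p) (suc x) = s≤s (∣p∣≤1+∣p∖x∣ p x)
∣p∣≤1+∣p∖x∣ (outside ∷ p) (suc x) = ∣p∣≤1+∣p∖x∣ p x

x∈p⇒∣p∣≡1+∣p∖x∣ : ∀ {p : Subset m} {x} → x ∈ p → ∣ p ∣ ≡ suc ∣ p ∖ x ∣
x∈p⇒∣p∣≡1+∣p∖x∣ {p = inside  ∷ p} {zero}  _        = refl
x∈p⇒∣p∣≡1+∣p∖x∣ {p = inside  ∷ p} {suc x} (there h) = cong suc (x∈p⇒∣p∣≡1+∣p∖x∣ h)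
x∈p⇒∣p∣≡1+∣p∖x∣ {p = outside ∷ p} {suc x} (there h) = x∈p⇒∣p∣≡1+∣p∖x∣ h

x∈p∖y⁺ : ∀ {p : Subset m} {x y} → x ∈ p → x ≢ y → x ∈ p ∖ y
x∈p∖y⁺ {p = p} {x} {y} x∈p x≢y = lookup⇒∈ (trans (lookup∘update′ x≢y p outside) ([]=⇒lookup x∈p))

x∉p∖x : ∀ (p : Subset m) x → x ∉ p ∖ x
x∉p∖x p x h with () ← trans (sym ([]=⇒lookup h)) (lookup∘update x p outside)

x∈p∖y⁻ : ∀ {p : Subset m} {x y} → x ∈ p ∖ y → x ∈ p × x ≢ y
x∈p∖y⁻ {p = p} {x} {y} h with x ≟ y
... | yes refl = ⊥-elim (x∉p∖x p x h)
... | no x≢y   = lookup⇒∈ (trans (sym (lookup∘update′ x≢y p outside)) ([]=⇒lookup h)) , x≢y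

j∉insertAt : ∀ (p : Subset m) j → j ∉ insertAt p j outside
j∉insertAt p j h with () ← trans (sym ([]=⇒lookup h)) (insertAt-lookup p j outside)

∈⁅x⁆∪⁅y⁆⁻ : ∀ {u x y : Fin m} → u ∈ ⁅ x ⁆ ∪ ⁅ y ⁆ → u ≡ x ⊎ u ≡ y
∈⁅x⁆∪⁅y⁆⁻ {x = x} {y} h = Sum.map (x∈⁅y⁆⇒x≡y x) (x∈⁅y⁆⇒x≡y y) (x∈p∪q⁻ ⁅ x ⁆ ⁅ y ⁆ h)

∈⁅x⁆∪⁅y⁆⁺ : ∀ {u x y : Fin m} → u ≡ x ⊎ u ≡ y → u ∈ ⁅ x ⁆ ∪ ⁅ y ⁆
∈⁅x⁆∪⁅y⁆⁺ (inj₁ refl) = x∈p∪q⁺ (inj₁ (x∈⁅x⁆ _))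
∈⁅x⁆∪⁅y⁆⁺ (inj₂ refl) = x∈p∪q⁺ (inj₂ (x∈⁅x⁆ _))

∈⁅x⁆∪⁅y⁆∪⁅z⁆⁻ : ∀ {u x y z : Fin m} → u ∈ ⁅ x ⁆ ∪ ⁅ y ⁆ ∪ ⁅ z ⁆ → u ≡ x ⊎ u ≡ y ⊎ u ≡ z
∈⁅x⁆∪⁅y⁆∪⁅z⁆⁻ {x = x} {y} {z} h =
  Sum.map (x∈⁅y⁆⇒x≡y x) ∈⁅x⁆∪⁅y⁆⁻ (x∈p∪q⁻ ⁅ x ⁆ (⁅ y ⁆ ∪ ⁅ z ⁆) h)

∈⁅x⁆∪⁅y⁆∪⁅z⁆⁺ : ∀ {u x y z : Fin m} → u ≡ x ⊎ u ≡ y ⊎ u ≡ z → u ∈ ⁅ x ⁆ ∪ ⁅ y ⁆ ∪ ⁅ z ⁆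
∈⁅x⁆∪⁅y⁆∪⁅z⁆⁺ (inj₁ refl) = x∈p∪q⁺ (inj₁ (x∈⁅x⁆ _))
∈⁅x⁆∪⁅y⁆∪⁅z⁆⁺ (inj₂ h)    = x∈p∪q⁺ (inj₂ (∈⁅x⁆∪⁅y⁆⁺ h))

⁅x⁆∪⁅y⁆⊆ : ∀ {p : Subset m} {x y} → x ∈ p → y ∈ p → ⁅ x ⁆ ∪ ⁅ y ⁆ ⊆ p
⁅x⁆∪⁅y⁆⊆ x∈p y∈p h = [ (λ { refl → x∈p }) , (λ { refl → y∈p }) ]′ (∈⁅x⁆∪⁅y⁆⁻ h)

⁅x⁆∪⁅y⁆∪⁅z⁆⊆ : ∀ {p : Subset m} {x y z} → x ∈ p → y ∈ p → z ∈ p → ⁅ x ⁆ ∪ ⁅ y ⁆ ∪ ⁅ z ⁆ ⊆ p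
⁅x⁆∪⁅y⁆∪⁅z⁆⊆ x∈p y∈p z∈p h =
  [ (λ { refl → x∈p }) , [ (λ { refl → y∈p }) , (λ { refl → z∈p }) ]′ ]′ (∈⁅x⁆∪⁅y⁆∪⁅z⁆⁻ h)

⊆⁅x⁆⇒≡⁅x⁆ : ∀ {p : Subset m} {x} → p ⊆ ⁅ x ⁆ → x ∈ p → p ≡ ⁅ x ⁆
⊆⁅x⁆⇒≡⁅x⁆ p⊆x x∈p = ⊆-antisym p⊆x (λ h → subst (_∈ _) (sym (x∈⁅y⁆⇒x≡y _ h)) x∈p)

⊆⁅x⁆⇒≡∅ : ∀ {p : Subset m} {x} → p ⊆ ⁅ x ⁆ → x ∉ p → p ≡ ∅
⊆⁅x⁆⇒≡∅ {x = x} p⊆x x∉p = Empty-unique λ (u , u∈p) → x∉p (subst (_∈ _) (x∈⁅y⁆⇒x≡y x (p⊆x u∈p)) u∈p)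

insertAt-∅ : ∀ (j : Fin (suc m)) → insertAt ∅ j outside ≡ ∅
insertAt-∅ zero            = refl
insertAt-∅ {suc m} (suc j) = cong (outside ∷_) (insertAt-∅ j)

insertAt-⁅⁆ : ∀ (j : Fin (suc m)) (a : Fin m) → insertAt ⁅ a ⁆ j outside ≡ ⁅ punchIn j a ⁆
insertAt-⁅⁆ zero    a       = refl
insertAt-⁅⁆ (suc j) zero    = cong (inside ∷_) (insertAt-∅ j)
insertAt-⁅⁆ (suc j) (suc a) = cong (outside ∷_) (insertAt-⁅⁆ j a)

insertAt-∪ : ∀ (p q : Subset m) j → insertAt (p ∪ q) j outside ≡ insertAt p j outside ∪ insertAt q j outside
insertAt-∪ p       q       zero    = refl
insertAt-∪ (x ∷ p) (y ∷ q) (suc j) = cong ((x ∨ y) ∷_) (insertAt-∪ p q j)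

insertAt-⁅x⁆∪⁅y⁆∪⁅z⁆ : ∀ (j : Fin (suc m)) x y z →
  insertAt (⁅ x ⁆ ∪ ⁅ y ⁆ ∪ ⁅ z ⁆) j outside ≡ ⁅ punchIn j x ⁆ ∪ ⁅ punchIn j y ⁆ ∪ ⁅ punchIn j z ⁆
insertAt-⁅x⁆∪⁅y⁆∪⁅z⁆ j x y z = begin
  insertAt (⁅ x ⁆ ∪ ⁅ y ⁆ ∪ ⁅ z ⁆) j outside
    ≡⟨ insertAt-∪ ⁅ x ⁆ (⁅ y ⁆ ∪ ⁅ z ⁆) j ⟩
  insertAt ⁅ x ⁆ j outside ∪ insertAt (⁅ y ⁆ ∪ ⁅ z ⁆) j outside
    ≡⟨ cong₂ _∪_ (insertAt-⁅⁆ j x) (insertAt-∪ ⁅ y ⁆ ⁅ z ⁆ j) ⟩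
  ⁅ punchIn j x ⁆ ∪ insertAt ⁅ y ⁆ j outside ∪ insertAt ⁅ z ⁆ j outside
    ≡⟨ cong₂ (λ p q → ⁅ punchIn j x ⁆ ∪ p ∪ q) (insertAt-⁅⁆ j y) (insertAt-⁅⁆ j z) ⟩
  ⁅ punchIn j x ⁆ ∪ ⁅ punchIn j y ⁆ ∪ ⁅ punchIn j z ⁆ ∎
  where open ≡-Reasoning

_≟A_ : (a b : Aug m) → Dec (a ≡ b)
_≟A_ = ≡-dec _≟_ _≟_

_∈A?_ : (a : Aug m) (A : Sub m) → Dec (a ∈A A)
inj₁ v ∈A? A = v ∈? proj₁ A
inj₂ v ∈A? A = v ∈? proj₂ A

infixl 5 _∖A_

_∖A_ : Sub m → Aug m → Sub m
(A₁ , A₂) ∖A inj₁ v = A₁ ∖ v , A₂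
(A₁ , A₂) ∖A inj₂ v = A₁ , A₂ ∖ v

b∈A∖a⁺ : ∀ {A : Sub m} {a b} → b ∈A A → b ≢ a → b ∈A (A ∖A a)
b∈A∖a⁺ {a = inj₁ v} {inj₁ u} h ne = x∈p∖y⁺ h (ne ∘ cong inj₁)
b∈A∖a⁺ {a = inj₁ v} {inj₂ u} h ne = h
b∈A∖a⁺ {a = inj₂ v} {inj₁ u} h ne = h
b∈A∖a⁺ {a = inj₂ v} {inj₂ u} h ne = x∈p∖y⁺ h (ne ∘ cong inj₂)

b∈A∖a⁻ : ∀ {A : Sub m} {a b} → b ∈A (A ∖A a) → b ∈A A × b ≢ a
b∈A∖a⁻ {a = inj₁ v} {inj₁ u} h = Product.map₂ (λ ne → ne ∘ inj₁-injective) (x∈p∖y⁻ h)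
b∈A∖a⁻ {a = inj₁ v} {inj₂ u} h = h , λ ()
b∈A∖a⁻ {a = inj₂ v} {inj₁ u} h = h , λ ()
b∈A∖a⁻ {a = inj₂ v} {inj₂ u} h = Product.map₂ (λ ne → ne ∘ inj₂-injective) (x∈p∖y⁻ h)

card≤1+card∖ : ∀ (A : Sub m) a → card A ≤ suc (card (A ∖A a))
card≤1+card∖ (A₁ , A₂) (inj₁ v) = +-mono-≤ (∣p∣≤1+∣p∖x∣ A₁ v) ≤-refl
card≤1+card∖ (A₁ , A₂) (inj₂ v) =
  ≤-trans (+-mono-≤ (≤-refl {∣ A₁ ∣}) (∣p∣≤1+∣p∖x∣ A₂ v)) (≤-reflexive (+-suc ∣ A₁ ∣ _))

a∈A⇒card≡1+card∖ : ∀ {A : Sub m} {a} → a ∈A A → card A ≡ suc (card (A ∖A a))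
a∈A⇒card≡1+card∖ {A = A₁ , A₂} {inj₁ v} h = cong (_+ ∣ A₂ ∣) (x∈p⇒∣p∣≡1+∣p∖x∣ h)
a∈A⇒card≡1+card∖ {A = A₁ , A₂} {inj₂ v} h =
  trans (cong (∣ A₁ ∣ +_) (x∈p⇒∣p∣≡1+∣p∖x∣ h)) (+-suc ∣ A₁ ∣ _)

card-empty : ∀ (A : Sub m) → ¬ Nonempty (proj₁ A) → ¬ Nonempty (proj₂ A) → card A ≡ 0
card-empty {m} (A₁ , A₂) e₁ e₂ =
  cong₂ _+_ (trans (cong ∣_∣ (Empty-unique e₁)) (∣⊥∣≡0 m)) (trans (cong ∣_∣ (Empty-unique e₂)) (∣⊥∣≡0 m))

b∈A∖x∖y⁻ : ∀ {A : Sub m} {x y b} → b ∈A (A ∖A x ∖A y) → b ∈A A × b ≢ x × b ≢ y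
b∈A∖x∖y⁻ {A = A} {x} h with b∈A∖a⁻ {A = A ∖A x} h
... | h′ , b≢y = Product.map₂ (_, b≢y) (b∈A∖a⁻ {A = A} h′)

3≤card⇒fresh : ∀ (A : Sub m) → 3 ≤ card A → ∀ x y → ∃ λ b → b ∈A A × b ≢ x × b ≢ y
3≤card⇒fresh A 3≤∣A∣ x y with nonempty? (proj₁ (A ∖A x ∖A y)) | nonempty? (proj₂ (A ∖A x ∖A y))
... | yes (u , h) | _            = inj₁ u , b∈A∖x∖y⁻ {A = A} h
... | no _         | yes (u , h) = inj₂ u , b∈A∖x∖y⁻ {A = A} h
... | no e₁        | no e₂       = ⊥-elim (3≰2 (begin
  3                                ≤⟨ 3≤∣A∣ ⟩
  card A                           ≤⟨ card≤1+card∖ A x ⟩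
  suc (card (A ∖A x))              ≤⟨ s≤s (card≤1+card∖ (A ∖A x) y) ⟩
  suc (suc (card (A ∖A x ∖A y))) ≡⟨ cong (λ c → suc (suc c)) (card-empty (A ∖A x ∖A y) e₁ e₂) ⟩
  2                                ∎))
  where
  open ≤-Reasoning
  3≰2 : ¬ 3 ≤ 2
  3≰2 (s≤s (s≤s ()))

3≤card⇒¬⊆₂ : ∀ (A : Sub m) → 3 ≤ card A → ∀ x y → ¬ (∀ b → b ∈A A → b ≡ x ⊎ b ≡ y)
3≤card⇒¬⊆₂ A 3≤∣A∣ x y A⊆xy with b , b∈A , b≢x , b≢y ← 3≤card⇒fresh A 3≤∣A∣ x y =
  [ b≢x , b≢y ]′ (A⊆xy b b∈A)

distinct⇒3≤card : ∀ {A : Sub m} {a b c} → a ∈A A → b ∈A A → c ∈A A → a ≢ b → a ≢ c → b ≢ c →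
                  3 ≤ card A
distinct⇒3≤card {A = A} {a} {b} {c} a∈A b∈A c∈A a≢b a≢c b≢c =
  ≤-trans (m≤m+n 3 _) (≤-reflexive (sym (begin
  card A                           ≡⟨ a∈A⇒card≡1+card∖ a∈A ⟩
  suc (card (A ∖A a))              ≡⟨ cong suc (a∈A⇒card≡1+card∖ b∈A∖a) ⟩
  suc (suc (card (A ∖A a ∖A b)))   ≡⟨ cong (λ c → suc (suc c)) (a∈A⇒card≡1+card∖ c∈A∖a∖b) ⟩
  3 + card (A ∖A a ∖A b ∖A c)      ∎)))
  where
  open ≡-Reasoning
  b∈A∖a : b ∈A (A ∖A a)
  b∈A∖a = b∈A∖a⁺ {A = A} b∈A (a≢b ∘ sym)
  c∈A∖a∖b : c ∈A (A ∖A a ∖A b)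
  c∈A∖a∖b = b∈A∖a⁺ {A = A ∖A a} (b∈A∖a⁺ {A = A} c∈A (a≢c ∘ sym)) (b≢c ∘ sym)

3≤card-transfer : ∀ {m′} {A : Sub m} {B : Sub m′} (_represents_ : Aug m′ → Aug m → Set) →
  (∀ {a b b′} → a represents b → a represents b′ → b ≡ b′) →
  (∀ b → b ∈A A → ∃ λ a → a ∈A B × a represents b) →
  ∀ {c} → c ∈A A → 3 ≤ card A → 3 ≤ card B
3≤card-transfer {A = A} _represents_ functional represented {c} c∈A 3≤∣A∣
  with b₁ , b₁∈A , b₁≢c , _     ← 3≤card⇒fresh A 3≤∣A∣ c c
  with b₂ , b₂∈A , b₂≢c , b₂≢b₁ ← 3≤card⇒fresh A 3≤∣A∣ c b₁
  with a₀ , a₀∈B , a₀~c  ← represented c c∈A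
     | a₁ , a₁∈B , a₁~b₁ ← represented b₁ b₁∈A
     | a₂ , a₂∈B , a₂~b₂ ← represented b₂ b₂∈A =
  distinct⇒3≤card a₀∈B a₁∈B a₂∈B
    (λ { refl → b₁≢c (functional a₁~b₁ a₀~c) })
    (λ { refl → b₂≢c (functional a₂~b₂ a₀~c) })
    (λ { refl → b₂≢b₁ (functional a₂~b₂ a₁~b₁) })

Sub-ext : ∀ {A B : Sub m} → (∀ a → a ∈A A → a ∈A B) → (∀ a → a ∈A B → a ∈A A) → A ≡ B
Sub-ext A⊆B B⊆A = cong₂ _,_ (⊆-antisym (A⊆B (inj₁ _)) (B⊆A (inj₁ _))) (⊆-antisym (A⊆B (inj₂ _)) (B⊆A (inj₂ _)))

-- Stars and sinks in triangle-free graphs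

StarAt : (Fin m → Fin m → Bool) → Subset m → Subset m → Sub m → Aug m → Set
StarAt adj I J A c = c ∈A A × (∀ a → a ∈A A → a ≢ c → AugAdj adj I J c a) × 3 ≤ card A

IsSink : Subset m → Subset m → (Fin m → Fin m → Bool) → Sub m → Aug m → Set
IsSink I J D A a = ∀ b → b ∈A A → b ≢ a → AugPar I J D b a

star-has-two-leaves : ∀ {adj I J A c x} → StarAt {m} adj I J A c → ¬ (∀ b → b ∈A A → b ≢ c → b ≡ x)
star-has-two-leaves {A = A} {c} {x} (_ , _ , 3≤∣A∣) leaves≡x =
  3≤card⇒¬⊆₂ A 3≤∣A∣ c x centre-or-leaf
  where
  centre-or-leaf : ∀ b → b ∈A A → b ≡ c ⊎ b ≡ x
  centre-or-leaf b b∈A with b ≟A c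
  ... | yes b≡c = inj₁ b≡c
  ... | no  b≢c = inj₂ (leaves≡x b b∈A b≢c)

¬star-at-primed : ∀ {adj I J A v} → ¬ StarAt {m} adj I J A (inj₂ v)
¬star-at-primed {adj = adj} {I} {J} {A} {v} star@(_ , adjacent , _) = star-has-two-leaves star leaf≡v
  where
  leaf≡v : ∀ b → b ∈A A → b ≢ inj₂ v → b ≡ inj₁ v
  leaf≡v (inj₁ u) b∈A b≢c = cong inj₁ (sym (proj₁ (adjacent (inj₁ u) b∈A b≢c)))
  leaf≡v (inj₂ u) b∈A b≢c = ⊥-elim (adjacent (inj₂ u) b∈A b≢c)

Omitted⇒centre : ∀ {adj I J} {A : Sub m} → Omitted adj I J A →
  ∃ λ w → w ∈ J × (∀ {u} → u ∈ proj₁ A → u ≢ w → T (adj u w)) × (∀ {u} → T (adj u w) → u ∈ proj₁ A)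
Omitted⇒centre {adj = adj} {A = A} (w , w∈J , a , b , (_ , a~w , b~w , N[w]) , A≡) =
  w , w∈J , leaf-adjacent , λ {u} u~w → subst (u ∈_) (sym A₁≡) (∈⁅x⁆∪⁅y⁆∪⁅z⁆⁺ (leaf (N[w] u u~w)))
  where
  A₁≡ : proj₁ A ≡ ⁅ a ⁆ ∪ ⁅ w ⁆ ∪ ⁅ b ⁆
  A₁≡ = [ cong proj₁ , cong proj₁ ]′ A≡
  leaf : ∀ {u} → u ≡ a ⊎ u ≡ b → u ≡ a ⊎ u ≡ w ⊎ u ≡ b
  leaf = [ inj₁ , inj₂ ∘ inj₂ ]′
  leaf-adjacent : ∀ {u} → u ∈ proj₁ A → u ≢ w → T (adj u w)
  leaf-adjacent {u} u∈A u≢w with ∈⁅x⁆∪⁅y⁆∪⁅z⁆⁻ (subst (u ∈_) A₁≡ u∈A)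
  ... | inj₁ refl        = a~w
  ... | inj₂ (inj₁ u≡w) = ⊥-elim (u≢w u≡w)
  ... | inj₂ (inj₂ refl) = b~w

TriangleFree : Graph m → Set
TriangleFree G = ∀ u v w → Adj G u v → Adj G v w → Adj G u w → ⊥

ArcsAreEdges : Graph m → (Fin m → Fin m → Bool) → Set
ArcsAreEdges G D = ∀ u v → Arc D u v → Adj G u v

module Augmented (G : Graph m) (triangle-free : TriangleFree G) (I J : Subset m) where

  AugAdj-sym : ∀ a b → AugAdj (adj G) I J a b → AugAdj (adj G) I J b a
  AugAdj-sym (inj₁ u) (inj₁ v) h       = adj-sym G u v h
  AugAdj-sym (inj₁ u) (inj₂ v) (e , h) = sym e , h
  AugAdj-sym (inj₂ u) (inj₁ v) (e , h) = sym e , h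

  AugAdj-triangleFree : ∀ a b c → AugAdj (adj G) I J a b → AugAdj (adj G) I J b c →
                        AugAdj (adj G) I J a c → ⊥
  AugAdj-triangleFree (inj₁ u) (inj₁ v) (inj₁ w) ab bc ac              = triangle-free u v w ab bc ac
  AugAdj-triangleFree (inj₂ u) (inj₁ v) (inj₁ w) (refl , _) bc (refl , _) = adj-irr G u bc
  AugAdj-triangleFree (inj₁ u) (inj₂ v) (inj₁ w) (refl , _) (refl , _) ac = adj-irr G u ac
  AugAdj-triangleFree (inj₁ u) (inj₁ v) (inj₂ w) ab (refl , _) (refl , _) = adj-irr G u ab

  AugPar⇒AugAdj : ∀ {D} → ArcsAreEdges G D → ∀ a b → AugPar I J D a b → AugAdj (adj G) I J a b
  AugPar⇒AugAdj D⊆G (inj₁ u) (inj₁ v) h = D⊆G u v h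
  AugPar⇒AugAdj D⊆G (inj₂ u) (inj₁ v) h = h

  -- If some a ≠ c were a sink of the star, a third vertex b of the star would close the
  -- triangle c – b → a – c.
  CCond⇔centre-is-sink : ∀ {D A c} → ArcsAreEdges G D → StarAt (adj G) I J A c →
                         CCond I J D A ⇔ IsSink I J D A c
  CCond⇔centre-is-sink {D} {A} {c} D⊆G (c∈A , star , 3≤∣A∣) = mk⇔ centre-sink (λ sink → c , c∈A , sink)
    where
    centre-sink : CCond I J D A → IsSink I J D A c
    centre-sink (a , a∈A , sink) with a ≟A c
    ... | yes refl = sink
    ... | no a≢c with 3≤card⇒fresh A 3≤∣A∣ c a
    ...   | b , b∈A , b≢c , b≢a =
      ⊥-elim (AugAdj-triangleFree c b a (star b b∈A b≢c)
               (AugPar⇒AugAdj D⊆G b a (sink b b∈A b≢a)) (star a a∈A a≢c))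

any-Aug? : ∀ {P : Aug m → Set} → (∀ a → Dec (P a)) → Dec (∃ P)
any-Aug? P? = map′
  [ (λ (v , h) → inj₁ v , h) , (λ (v , h) → inj₂ v , h) ]′
  (λ { (inj₁ v , h) → inj₁ (v , h) ; (inj₂ v , h) → inj₂ (v , h) })
  (any? (P? ∘ inj₁) ⊎-dec any? (P? ∘ inj₂))

all-Aug? : ∀ {P : Aug m → Set} → (∀ a → Dec (P a)) → Dec (∀ a → P a)
all-Aug? P? = map′
  (λ (f , g) → λ { (inj₁ v) → f v ; (inj₂ v) → g v })
  (λ h → h ∘ inj₁ , h ∘ inj₂)
  (all? (P? ∘ inj₁) ×-dec all? (P? ∘ inj₂))

indicator : ∀ {P : Set} → Dec P → ℚ
indicator (yes _) = 1ℚ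
indicator (no _)  = 0ℚ

indicator-spec : ∀ {P : Set} (P? : Dec P) → (P → indicator P? ≡ 1ℚ) × (¬ P → indicator P? ≡ 0ℚ)
indicator-spec (yes p) = (λ _ → refl) , (λ ¬p → ⊥-elim (¬p p))
indicator-spec (no ¬p) = (λ p → ⊥-elim (¬p p)) , (λ _ → refl)

module _ (I J : Subset m) (D : Fin m → Fin m → Bool) where

  AugPar? : ∀ a b → Dec (AugPar I J D a b)
  AugPar? (inj₁ u) (inj₁ v) = T? (D u v)
  AugPar? (inj₁ u) (inj₂ v) = no λ ()
  AugPar? (inj₂ u) (inj₁ v) = (u ≟ v) ×-dec ((u ∈? I) ⊎-dec (u ∈? J))
  AugPar? (inj₂ u) (inj₂ v) = no λ ()

  CCond? : ∀ A → Dec (CCond I J D A)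
  CCond? A = any-Aug? λ a → (a ∈A? A) ×-dec all-Aug? λ b →
    (b ∈A? A) →-dec (¬? (b ≟A a) →-dec AugPar? b a)

  imset : Sub m → ℚ
  imset A = indicator (CCond? A)

  imset-isImset : IsImset I J D imset
  imset-isImset A = indicator-spec (CCond? A)

imset-vertex : ∀ {adj I J} {D : Fin m → Fin m → Bool} → Admissible adj J D → Vertex adj I J (imset I J D)
imset-vertex {I = I} {J} {D} adm = D , adm , imset-isImset I J D

imset-cong : ∀ {m′} {I J : Subset m} {D A c} {I′ J′ : Subset m′} {D′ A′ c′} →
             IsImset I J D c → IsImset I′ J′ D′ c′ →
             CCond I J D A ⇔ CCond I′ J′ D′ A′ → c′ A′ ≡ c A
imset-cong {I = I} {J} {D} {A} c-imset c′-imset same with CCond? I J D A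
... | yes h = trans (proj₁ (c′-imset _) (to same h)) (sym (proj₁ (c-imset A) h))
... | no ¬h = trans (proj₂ (c′-imset _) (¬h ∘ from same)) (sym (proj₂ (c-imset A) ¬h))

-- Convex hulls under a relabelling of coordinates

Weighted : ((Sub m → ℚ) → Set) → ℚ × (Sub m → ℚ) → Set
Weighted V p = (0ℚ ≤ℚ proj₁ p) × V (proj₂ p)

InHull : ((Sub m → ℚ) → Set) → (Sub m → Set) → (Sub m → ℚ) → Set
InHull V C x = Σ (List (ℚ × (Sub _ → ℚ))) λ L →
  All (Weighted V) L × weightSum L ≡ 1ℚ × (∀ A → C A → x A ≡ wsum L A)

module _ {m′} {V : (Sub m → ℚ) → Set} {V′ : (Sub m′ → ℚ) → Set}
         (Rel : (Sub m → ℚ) → (Sub m′ → ℚ) → Set)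
         (vertex-map : ∀ c → V c → ∃ λ c′ → V′ c′ × Rel c c′) where

  map-combination : ∀ L → All (Weighted V) L →
    ∃ λ L′ → All (Weighted V′) L′ × weightSum L′ ≡ weightSum L
           × (∀ A B → (∀ c c′ → Rel c c′ → c′ B ≡ c A) → wsum L′ B ≡ wsum L A)
  map-combination []            []              = [] , [] , refl , λ _ _ _ → refl
  map-combination ((w , c) ∷ L) ((0≤w , v) ∷ vs)
    with c′ , v′ , rel ← vertex-map c v
       | L′ , vs′ , weights , sums ← map-combination L vs =
    (w , c′) ∷ L′ , (0≤w , v′) ∷ vs′ , cong (w +ℚ_) weights ,
    λ A B agree → cong₂ (λ a s → (w *ℚ a) +ℚ s) (agree c c′ rel) (sums A B agree)

module Relabelling {m′} (Kept : Sub m → Set) (R : Sub m → Sub m′) where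

  Agrees : (Sub m → ℚ) → (Sub m′ → ℚ) → Set
  Agrees x y = ∀ A → Kept A → y (R A) ≡ x A

  hull-push : ∀ {V C} {V′ : (Sub m′ → ℚ) → Set} {C′} →
    (∀ B → C′ B → ∃ λ A → Kept A × R A ≡ B) → (∀ A → Kept A → C A) →
    (∀ c → V c → ∃ λ c′ → V′ c′ × Agrees c c′) →
    ∀ {x y} → InHull V C x → Agrees x y → InHull V′ C′ y
  hull-push {C′ = C′} R-onto Kept⊆C vertex-map {x} {y} (L , vs , total , x≡) x~y
    with L′ , vs′ , total′ , sums ← map-combination Agrees vertex-map L vs =
    L′ , vs′ , trans total′ total , y≡
    where
    y≡ : ∀ B → C′ B → y B ≡ wsum L′ B
    y≡ B B∈C′ with A , kept , refl ← R-onto B B∈C′ =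
      trans (x~y A kept) (trans (x≡ A (Kept⊆C A kept)) (sym (sums A (R A) λ _ _ c~c′ → c~c′ A kept)))

  hull-pull : ∀ {V C} {V′ : (Sub m′ → ℚ) → Set} {C′} →
    (∀ A → Kept A → C′ (R A)) →
    (∀ c′ → V′ c′ → ∃ λ c → V c × Agrees c c′) →
    ∀ {y} → InHull V′ C′ y → ∃ λ x → InHull V C x × Agrees x y
  hull-pull R-coord vertex-map {y} (L′ , vs′ , total′ , y≡)
    with L , vs , total , sums ← map-combination (λ c′ c → Agrees c c′) vertex-map L′ vs′ =
    wsum L , (L , vs , trans total total′ , λ _ _ → refl) ,
    λ A kept → trans (y≡ (R A) (R-coord A kept)) (sym (sums (R A) A λ _ _ c~c′ → sym (c~c′ A kept)))

module _ (G : Graph m) (acyclic : ∀ cs → ¬ IsCycle G cs) where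

  Adj⇒≢ : ∀ {u v} → Adj G u v → u ≢ v
  Adj⇒≢ {u} u~v refl = adj-irr G u u~v

  acyclic⇒triangleFree : TriangleFree G
  acyclic⇒triangleFree u v w u~v v~w u~w = acyclic (u ∷ v ∷ w ∷ [])
    ( ((Adj⇒≢ u~v ∷ Adj⇒≢ u~w ∷ []) ∷ (Adj⇒≢ v~w ∷ []) ∷ [] ∷ [])
    , s≤s (s≤s (s≤s z≤n))
    , u~v ∷ v~w ∷ adj-sym G u w u~w ∷ [-])

  acyclic⇒no-4-cycle : ∀ {u v w x} → u ≢ w → v ≢ x →
                       Adj G u v → Adj G v w → Adj G w x → Adj G x u → ⊥
  acyclic⇒no-4-cycle {u} {v} {w} {x} u≢w v≢x u~v v~w w~x x~u = acyclic (u ∷ v ∷ w ∷ x ∷ [])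
    ( ((Adj⇒≢ u~v ∷ u≢w ∷ Adj⇒≢ (adj-sym G x u x~u) ∷ []) ∷ (Adj⇒≢ v~w ∷ v≢x ∷ []) ∷ (Adj⇒≢ w~x ∷ []) ∷ [] ∷ [])
    , s≤s (s≤s (s≤s z≤n))
    , u~v ∷ v~w ∷ w~x ∷ x~u ∷ [-])

-- Contracting the path i – j – k of a gluing tree to the edge i – k

module Contraction {n : ℕ} (G : GluingTree (suc n)) (j i k : Fin (suc n))
                   (j∈J : j ∈ GluingTree.J G) (N[j] : Nbhd2 (GluingTree.tree G) j i k) where

  open GluingTree G

  adjT : Fin (suc n) → Fin (suc n) → Bool
  adjT = adj tree

  infix 4 _~_ _~ˣ_

  _~_ : Fin (suc n) → Fin (suc n) → Set
  _~_ = Adj tree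

  ~-sym : ∀ {u v} → u ~ v → v ~ u
  ~-sym = adj-sym tree _ _

  ~⇒≢ : ∀ {u v} → u ~ v → u ≢ v
  ~⇒≢ = Adj⇒≢ tree (proj₂ isTree)

  triangle-free : TriangleFree tree
  triangle-free = acyclic⇒triangleFree tree (proj₂ isTree)

  i≢k : i ≢ k
  i≢k = proj₁ N[j]

  i~j : i ~ j
  i~j = proj₁ (proj₂ N[j])

  k~j : k ~ j
  k~j = proj₁ (proj₂ (proj₂ N[j]))

  N[j]⊆ik : ∀ {l} → l ~ j → l ≡ i ⊎ l ≡ k
  N[j]⊆ik = proj₂ (proj₂ (proj₂ N[j])) _

  i≢j : i ≢ j
  i≢j = ~⇒≢ i~j

  k≢j : k ≢ j
  k≢j = ~⇒≢ k~j

  ¬i~k : ¬ i ~ k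
  ¬i~k = triangle-free i j k i~j (~-sym k~j)

  common-neighbour≡j : ∀ {w} → i ~ w → k ~ w → w ≡ j
  common-neighbour≡j {w} i~w k~w with w ≟ j
  ... | yes w≡j = w≡j
  ... | no  w≢j = ⊥-elim (acyclic⇒no-4-cycle tree (proj₂ isTree) i≢k (w≢j ∘ sym)
                           i~j (~-sym k~j) k~w (~-sym i~w))

  J-nonadjacent : ∀ {u v} → u ∈ J → v ∈ J → ¬ u ~ v
  J-nonadjacent u∈J v∈J = nonadj _ _ (inj₂ u∈J) (inj₂ v∈J)

  N[j]∉IJ : ∀ {v} → v ~ j → ¬ InIJ I J v
  N[j]∉IJ v~j v∈IJ = nonadj _ j v∈IJ (inj₂ j∈J) v~j

  ι : Fin n → Fin (suc n)
  ι = punchIn j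

  ι≢j : ∀ u → ι u ≢ j
  ι≢j = punchInᵢ≢i j

  ι-injective : ∀ {u v} → ι u ≡ ι v → u ≡ v
  ι-injective = punchIn-injective j _ _

  ι-onto : ∀ {a} → a ≢ j → ∃ λ u → ι u ≡ a
  ι-onto a≢j = punchOut (a≢j ∘ sym) , punchIn-punchOut (a≢j ∘ sym)

  i′ k′ : Fin n
  i′ = proj₁ (ι-onto i≢j)
  k′ = proj₁ (ι-onto k≢j)

  ι-i′ : ι i′ ≡ i
  ι-i′ = proj₂ (ι-onto i≢j)

  ι-k′ : ι k′ ≡ k
  ι-k′ = proj₂ (ι-onto k≢j)

  IX JX : Subset n
  IX = removeAt I j
  JX = removeAt J j

  ∈J-ι⁻ : ∀ {u} → ι u ∈ J → u ∈ JX
  ∈J-ι⁻ u∈J = lookup⇒∈ (trans (lookup-removeAt J j _) ([]=⇒lookup u∈J))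

  ∈J-ι⁺ : ∀ {u} → u ∈ JX → ι u ∈ J
  ∈J-ι⁺ u∈JX = lookup⇒∈ (trans (sym (lookup-removeAt J j _)) ([]=⇒lookup u∈JX))

  IJ-ι⁻ : ∀ {u} → InIJ I J (ι u) → InIJ IX JX u
  IJ-ι⁻ (inj₁ u∈I) = inj₁ (lookup⇒∈ (trans (lookup-removeAt I j _) ([]=⇒lookup u∈I)))
  IJ-ι⁻ (inj₂ u∈J) = inj₂ (∈J-ι⁻ u∈J)

  IJ-ι⁺ : ∀ {u} → InIJ IX JX u → InIJ I J (ι u)
  IJ-ι⁺ (inj₁ u∈IX) = inj₁ (lookup⇒∈ (trans (sym (lookup-removeAt I j _)) ([]=⇒lookup u∈IX)))
  IJ-ι⁺ (inj₂ u∈JX) = inj₂ (∈J-ι⁺ u∈JX)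

  adjX : Fin n → Fin n → Bool
  adjX = Xadj adjT j i k

  _~ˣ_ : Fin n → Fin n → Set
  u ~ˣ v = T (adjX u v)

  NewEdge : Fin n → Fin n → Set
  NewEdge u v = (ι u ≡ i × ι v ≡ k) ⊎ (ι u ≡ k × ι v ≡ i)

  ~ˣ-view : ∀ {u v} → u ~ˣ v → ι u ~ ι v ⊎ NewEdge u v
  ~ˣ-view h with to T-∨ h
  ... | inj₁ old = inj₁ old
  ... | inj₂ new = inj₂ (Sum.map ends ends (to T-∨ new))
    where
    ends : ∀ {a b c d : Fin (suc n)} → T (⌊ a ≟ b ⌋ ∧ ⌊ c ≟ d ⌋) → a ≡ b × c ≡ d
    ends {a} {b} h = Product.map toWitness toWitness (to (T-∧ {⌊ a ≟ b ⌋}) h)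

  ~ˣ-old : ∀ {u v} → ι u ~ ι v → u ~ˣ v
  ~ˣ-old old = from T-∨ (inj₁ old)

  ~ˣ-new : ∀ {u v} → NewEdge u v → u ~ˣ v
  ~ˣ-new {u} {v} new = from (T-∨ {adjT (ι u) (ι v)}) (inj₂ (from T-∨ (Sum.map ends ends new)))
    where
    ends : ∀ {a b c d : Fin (suc n)} → a ≡ b × c ≡ d → T (⌊ a ≟ b ⌋ ∧ ⌊ c ≟ d ⌋)
    ends {a} {b} (a≡b , c≡d) = from (T-∧ {⌊ a ≟ b ⌋}) (fromWitness a≡b , fromWitness c≡d)

  NewEdge-sym : ∀ {u v} → NewEdge u v → NewEdge v u
  NewEdge-sym (inj₁ (u≡i , v≡k)) = inj₂ (v≡k , u≡i)
  NewEdge-sym (inj₂ (u≡k , v≡i)) = inj₁ (v≡i , u≡k)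

  NewEdge-irrefl : ∀ {u} → ¬ NewEdge u u
  NewEdge-irrefl (inj₁ (u≡i , u≡k)) = i≢k (trans (sym u≡i) u≡k)
  NewEdge-irrefl (inj₂ (u≡k , u≡i)) = i≢k (trans (sym u≡i) u≡k)

  NewEdge-unique : ∀ {u v w} → NewEdge u v → NewEdge u w → v ≡ w
  NewEdge-unique (inj₁ (_ , v≡k))   (inj₁ (_ , w≡k))   = ι-injective (trans v≡k (sym w≡k))
  NewEdge-unique (inj₂ (_ , v≡i))   (inj₂ (_ , w≡i))   = ι-injective (trans v≡i (sym w≡i))
  NewEdge-unique (inj₁ (u≡i , _))   (inj₂ (u≡k , _))   = ⊥-elim (i≢k (trans (sym u≡i) u≡k))
  NewEdge-unique (inj₂ (u≡k , _))   (inj₁ (u≡i , _))   = ⊥-elim (i≢k (trans (sym u≡i) u≡k))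

  NewEdge⇒~j : ∀ {u v} → NewEdge u v → ι u ~ j
  NewEdge⇒~j (inj₁ (refl , _)) = i~j
  NewEdge⇒~j (inj₂ (refl , _)) = k~j

  NewEdge⇒¬~ : ∀ {u v} → NewEdge u v → ¬ ι u ~ ι v
  NewEdge⇒¬~ (inj₁ (refl , refl)) = ¬i~k
  NewEdge⇒¬~ (inj₂ (refl , refl)) = ¬i~k ∘ ~-sym

  NewEdge-no-common-neighbour : ∀ {u v w} → NewEdge u v → ι u ~ ι w → ι v ~ ι w → ⊥
  NewEdge-no-common-neighbour {w = w} (inj₁ (refl , refl)) i~w k~w = ι≢j w (common-neighbour≡j i~w k~w)
  NewEdge-no-common-neighbour {w = w} (inj₂ (refl , refl)) k~w i~w = ι≢j w (common-neighbour≡j i~w k~w)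

  ~ˣ-sym : ∀ u v → u ~ˣ v → v ~ˣ u
  ~ˣ-sym u v u~v = [ ~ˣ-old ∘ ~-sym , ~ˣ-new ∘ NewEdge-sym ]′ (~ˣ-view u~v)

  ~ˣ-irr : ∀ u → ¬ u ~ˣ u
  ~ˣ-irr u u~u = [ adj-irr tree (ι u) , NewEdge-irrefl ]′ (~ˣ-view u~u)

  X : Graph n
  X = record { adj = adjX ; adj-sym = ~ˣ-sym ; adj-irr = ~ˣ-irr }

  -- A triangle of X uses the new edge at most once (it is the only edge between i′ and k′),
  -- and a triangle through it would give i and k a common neighbour other than j.
  X-triangleFree : TriangleFree X
  X-triangleFree u v w u~v v~w u~w with ~ˣ-view u~v | ~ˣ-view v~w | ~ˣ-view u~w
  ... | inj₁ uv  | inj₁ vw  | inj₁ uw  = triangle-free (ι u) (ι v) (ι w) uv vw uw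
  ... | inj₂ uv  | inj₂ vw  | _        = ~ˣ-irr u (subst (u ~ˣ_) (sym (NewEdge-unique (NewEdge-sym uv) vw)) u~w)
  ... | inj₂ uv  | inj₁ _   | inj₂ uw  = ~ˣ-irr v (subst (v ~ˣ_) (sym (NewEdge-unique uv uw)) v~w)
  ... | inj₁ _   | inj₂ vw  | inj₂ uw  =
        ~ˣ-irr u (subst (u ~ˣ_) (NewEdge-unique (NewEdge-sym vw) (NewEdge-sym uw)) u~v)
  ... | inj₂ uv  | inj₁ vw  | inj₁ uw  = NewEdge-no-common-neighbour uv uw vw
  ... | inj₁ uv  | inj₂ vw  | inj₁ uw  = NewEdge-no-common-neighbour vw (~-sym uv) (~-sym uw)
  ... | inj₁ uv  | inj₁ vw  | inj₂ uw  = NewEdge-no-common-neighbour uw uv (~-sym vw)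

  module AugT = Augmented tree triangle-free I J
  module AugX = Augmented X X-triangleFree IX JX

  ιA : Aug n → Aug (suc n)
  ιA = Sum.map ι ι

  ιA-injective : ∀ {a b} → ιA a ≡ ιA b → a ≡ b
  ιA-injective {inj₁ _} {inj₁ _} e = cong inj₁ (ι-injective (inj₁-injective e))
  ιA-injective {inj₂ _} {inj₂ _} e = cong inj₂ (ι-injective (inj₂-injective e))

  ιA-onto : ∀ {b} → b ≢ inj₁ j → b ≢ inj₂ j → ∃ λ a → ιA a ≡ b
  ιA-onto {inj₁ v} b≢j _ = Product.map inj₁ (cong inj₁) (ι-onto (b≢j ∘ cong inj₁))
  ιA-onto {inj₂ v} _ b≢j = Product.map inj₂ (cong inj₂) (ι-onto (b≢j ∘ cong inj₂))

  NewEdgeA : Aug n → Aug n → Set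
  NewEdgeA (inj₁ u) (inj₁ v) = NewEdge u v
  NewEdgeA _        _        = ⊥

  AugAdj-ι⁻ : ∀ a b → AugAdj adjT I J (ιA a) (ιA b) → AugAdj adjX IX JX a b
  AugAdj-ι⁻ (inj₁ u) (inj₁ v) old          = ~ˣ-old old
  AugAdj-ι⁻ (inj₁ u) (inj₂ v) (e , v∈IJ)   = ι-injective e , IJ-ι⁻ v∈IJ
  AugAdj-ι⁻ (inj₂ u) (inj₁ v) (e , u∈IJ)   = ι-injective e , IJ-ι⁻ u∈IJ

  AugAdj-ι⁺ : ∀ a b → AugAdj adjX IX JX a b → AugAdj adjT I J (ιA a) (ιA b) ⊎ NewEdgeA a b
  AugAdj-ι⁺ (inj₁ u) (inj₁ v) u~v        = ~ˣ-view u~v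
  AugAdj-ι⁺ (inj₁ u) (inj₂ v) (e , v∈IJ) = inj₁ (cong ι e , IJ-ι⁺ v∈IJ)
  AugAdj-ι⁺ (inj₂ u) (inj₁ v) (e , u∈IJ) = inj₁ (cong ι e , IJ-ι⁺ u∈IJ)

  J-neighbour≢j : ∀ {l w} → w ∈ J → l ~ w → l ≢ j
  J-neighbour≢j w∈J l~w refl = J-nonadjacent j∈J w∈J l~w

  -- The new edge avoids J, because i and k are adjacent to j ∈ J.
  JX-edge-old : ∀ {u w} → w ∈ JX → u ~ˣ w → ι u ~ ι w
  JX-edge-old w∈JX u~w with ~ˣ-view u~w
  ... | inj₁ old = old
  ... | inj₂ new = ⊥-elim (N[j]∉IJ (NewEdge⇒~j (NewEdge-sym new)) (inj₂ (∈J-ι⁺ w∈JX)))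

  Nbhd2-ι⁺ : ∀ {w a b} → w ∈ JX → Nbhd2 X w a b → Nbhd2 tree (ι w) (ι a) (ι b)
  Nbhd2-ι⁺ {w} {a} {b} w∈JX (a≢b , a~w , b~w , N[w]) =
    a≢b ∘ ι-injective , JX-edge-old w∈JX a~w , JX-edge-old w∈JX b~w , N[ιw]
    where
    N[ιw] : ∀ l → l ~ ι w → l ≡ ι a ⊎ l ≡ ι b
    N[ιw] l l~w with u , refl ← ι-onto (J-neighbour≢j (∈J-ι⁺ w∈JX) l~w) =
      Sum.map (cong ι) (cong ι) (N[w] u (~ˣ-old l~w))

  Nbhd2-ι⁻ : ∀ {w a b} → ι w ∈ J → Nbhd2 tree (ι w) (ι a) (ι b) → Nbhd2 X w a b
  Nbhd2-ι⁻ w∈J (a≢b , a~w , b~w , N[w]) =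
    a≢b ∘ cong ι , ~ˣ-old a~w , ~ˣ-old b~w ,
    λ l l~w → Sum.map ι-injective ι-injective (N[w] (ι l) (JX-edge-old (∈J-ι⁻ w∈J) l~w))

  R : Sub (suc n) → Sub n
  R = relabel j i k

  Endpoint : Aug n → Set
  Endpoint (inj₁ u) = ι u ≡ i ⊎ ι u ≡ k
  Endpoint (inj₂ _) = ⊥

  private
    marked : Subset (suc n) → Subset (suc n)
    marked A₁ = (A₁ [ i ]≔ inside) [ k ]≔ inside

    lookup-marked : ∀ A₁ {v} → v ≡ i ⊎ v ≡ k → lookup (marked A₁) v ≡ inside
    lookup-marked A₁ (inj₁ refl) = trans (lookup∘update′ i≢k (A₁ [ i ]≔ inside) inside) (lookup∘update i A₁ inside)
    lookup-marked A₁ (inj₂ refl) = lookup∘update k (A₁ [ i ]≔ inside) inside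

    lookup-unmarked : ∀ A₁ {v} → v ≢ i → v ≢ k → lookup (marked A₁) v ≡ lookup A₁ v
    lookup-unmarked A₁ v≢i v≢k = trans (lookup∘update′ v≢k (A₁ [ i ]≔ inside) inside) (lookup∘update′ v≢i A₁ inside)

  ∈-relabel⁻ : ∀ A a → a ∈A R A → ιA a ∈A A ⊎ (j ∈ proj₁ A × Endpoint a)
  ∈-relabel⁻ (A₁ , A₂) (inj₂ u) h = inj₁ (lookup⇒∈ (trans (sym (lookup-removeAt A₂ j u)) ([]=⇒lookup h)))
  ∈-relabel⁻ (A₁ , A₂) (inj₁ u) h with lookup A₁ j in j∈?A
  ... | false = inj₁ (lookup⇒∈ (trans (sym (lookup-removeAt A₁ j u)) ([]=⇒lookup h)))
  ... | true with ι u ≟ i | ι u ≟ k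
  ...   | yes u≡i | _       = inj₂ (lookup⇒∈ j∈?A , inj₁ u≡i)
  ...   | no _    | yes u≡k = inj₂ (lookup⇒∈ j∈?A , inj₂ u≡k)
  ...   | no u≢i  | no u≢k  = inj₁ (lookup⇒∈ (begin
    lookup A₁ (ι u)                     ≡⟨ lookup-unmarked A₁ u≢i u≢k ⟨
    lookup (marked A₁) (ι u)            ≡⟨ lookup-removeAt (marked A₁) j u ⟨
    lookup (removeAt (marked A₁) j) u   ≡⟨ []=⇒lookup h ⟩
    inside                              ∎))
    where open ≡-Reasoning

  ∈-relabel⁺ : ∀ A a → ιA a ∈A A ⊎ (j ∈ proj₁ A × Endpoint a) → a ∈A R A
  ∈-relabel⁺ (A₁ , A₂) (inj₂ u) (inj₁ h) = lookup⇒∈ (trans (lookup-removeAt A₂ j u) ([]=⇒lookup h))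
  ∈-relabel⁺ (A₁ , A₂) (inj₁ u) h with lookup A₁ j in j∈?A
  ∈-relabel⁺ (A₁ , A₂) (inj₁ u) (inj₁ h) | false =
    lookup⇒∈ (trans (lookup-removeAt A₁ j u) ([]=⇒lookup h))
  ∈-relabel⁺ (A₁ , A₂) (inj₁ u) (inj₂ (j∈A , _)) | false with () ← trans (sym ([]=⇒lookup j∈A)) j∈?A
  ∈-relabel⁺ (A₁ , A₂) (inj₁ u) (inj₂ (_ , endpoint)) | true =
    lookup⇒∈ (trans (lookup-removeAt (marked A₁) j u) (lookup-marked A₁ endpoint))
  ∈-relabel⁺ (A₁ , A₂) (inj₁ u) (inj₁ h) | true with ι u ≟ i | ι u ≟ k
  ... | yes u≡i | _       = lookup⇒∈ (trans (lookup-removeAt (marked A₁) j u) (lookup-marked A₁ (inj₁ u≡i)))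
  ... | no _    | yes u≡k = lookup⇒∈ (trans (lookup-removeAt (marked A₁) j u) (lookup-marked A₁ (inj₂ u≡k)))
  ... | no u≢i  | no u≢k  =
    lookup⇒∈ (trans (lookup-removeAt (marked A₁) j u) (trans (lookup-unmarked A₁ u≢i u≢k) ([]=⇒lookup h)))

  StarT : Sub (suc n) → Aug (suc n) → Set
  StarT = StarAt adjT I J

  StarX : Sub n → Aug n → Set
  StarX = StarAt adjX IX JX

  Kept′ : Sub (suc n) → Set
  Kept′ = Kept adjT I J j i k

  module StarAtJ {A : Sub (suc n)} (star : StarT A (inj₁ j)) where

    leaf₁ : ∀ {u} → u ∈ proj₁ A → u ≢ j → u ≡ i ⊎ u ≡ k
    leaf₁ {u} u∈A u≢j = N[j]⊆ik (~-sym (proj₁ (proj₂ star) (inj₁ u) u∈A (u≢j ∘ inj₁-injective)))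

    leaf₂ : ∀ {u} → u ∈ proj₂ A → u ≡ j
    leaf₂ {u} u∈A = sym (proj₁ (proj₁ (proj₂ star) (inj₂ u) u∈A λ ()))

    ⊆₁ : ∀ {S} → j ∈ S → (i ∈ proj₁ A → i ∈ S) → (k ∈ proj₁ A → k ∈ S) → proj₁ A ⊆ S
    ⊆₁ j∈S i∈S k∈S {u} u∈A with u ≟ j
    ... | yes refl = j∈S
    ... | no  u≢j with leaf₁ u∈A u≢j
    ...   | inj₁ refl = i∈S u∈A
    ...   | inj₂ refl = k∈S u∈A

    ⊆₂ : proj₂ A ⊆ ⁅ j ⁆
    ⊆₂ u∈A = subst (_∈ ⁅ j ⁆) (sym (leaf₂ u∈A)) (x∈⁅x⁆ j)

    single-leaf : ∀ {x} → (i ∈ proj₁ A → inj₁ i ≡ x) → (k ∈ proj₁ A → inj₁ k ≡ x) →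
                  (j ∈ proj₂ A → inj₂ j ≡ x) → ⊥
    single-leaf {x} i≡x k≡x j′≡x = star-has-two-leaves star leaf≡x
      where
      leaf≡x : ∀ b → b ∈A A → b ≢ inj₁ j → b ≡ x
      leaf≡x (inj₁ u) u∈A u≢j with leaf₁ u∈A (u≢j ∘ cong inj₁)
      ... | inj₁ refl = i≡x u∈A
      ... | inj₂ refl = k≡x u∈A
      leaf≡x (inj₂ u) u∈A _ with refl ← leaf₂ u∈A = j′≡x u∈A

    ≡ijk : i ∈ proj₁ A → k ∈ proj₁ A → proj₁ A ≡ ⁅ i ⁆ ∪ ⁅ j ⁆ ∪ ⁅ k ⁆
    ≡ijk i∈A k∈A = ⊆-antisym
      (⊆₁ (∈⁅x⁆∪⁅y⁆∪⁅z⁆⁺ (inj₂ (inj₁ refl))) (λ _ → ∈⁅x⁆∪⁅y⁆∪⁅z⁆⁺ (inj₁ refl))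
          (λ _ → ∈⁅x⁆∪⁅y⁆∪⁅z⁆⁺ (inj₂ (inj₂ refl))))
      (⁅x⁆∪⁅y⁆∪⁅z⁆⊆ i∈A (proj₁ star) k∈A)

    ≡ij : i ∈ proj₁ A → k ∉ proj₁ A → proj₁ A ≡ ⁅ i ⁆ ∪ ⁅ j ⁆
    ≡ij i∈A k∉A = ⊆-antisym
      (⊆₁ (∈⁅x⁆∪⁅y⁆⁺ (inj₂ refl)) (λ _ → ∈⁅x⁆∪⁅y⁆⁺ (inj₁ refl)) (⊥-elim ∘ k∉A))
      (⁅x⁆∪⁅y⁆⊆ i∈A (proj₁ star))

    ≡jk : i ∉ proj₁ A → k ∈ proj₁ A → proj₁ A ≡ ⁅ j ⁆ ∪ ⁅ k ⁆
    ≡jk i∉A k∈A = ⊆-antisym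
      (⊆₁ (∈⁅x⁆∪⁅y⁆⁺ (inj₁ refl)) (⊥-elim ∘ i∉A) (λ _ → ∈⁅x⁆∪⁅y⁆⁺ (inj₂ refl)))
      (⁅x⁆∪⁅y⁆⊆ (proj₁ star) k∈A)

  -- A star centred at j lies in {i, j, k, j′}, so with at least three elements it is one of the
  -- omitted or forgotten coordinates.
  ¬kept-star-at-j : ∀ A → Kept′ A → ¬ StarT A (inj₁ j)
  ¬kept-star-at-j A ((_ , ¬omitted) , A≢ij , A≢jk) star
    with i ∈? proj₁ A | k ∈? proj₁ A | j ∈? proj₂ A
  ... | yes i∈A | yes k∈A | no  j′∉A =
    ¬omitted (j , j∈J , i , k , N[j] , inj₁ (cong₂ _,_ (≡ijk i∈A k∈A) (⊆⁅x⁆⇒≡∅ ⊆₂ j′∉A)))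
    where open StarAtJ star
  ... | yes i∈A | yes k∈A | yes j′∈A =
    ¬omitted (j , j∈J , i , k , N[j] , inj₂ (cong₂ _,_ (≡ijk i∈A k∈A) (⊆⁅x⁆⇒≡⁅x⁆ ⊆₂ j′∈A)))
    where open StarAtJ star
  ... | yes i∈A | no  k∉A | yes j′∈A = A≢ij (cong₂ _,_ (≡ij i∈A k∉A) (⊆⁅x⁆⇒≡⁅x⁆ ⊆₂ j′∈A))
    where open StarAtJ star
  ... | no  i∉A | yes k∈A | yes j′∈A = A≢jk (cong₂ _,_ (≡jk i∉A k∈A) (⊆⁅x⁆⇒≡⁅x⁆ ⊆₂ j′∈A))
    where open StarAtJ star
  ... | yes _   | no  k∉A | no  j′∉A = StarAtJ.single-leaf star (λ _ → refl) (⊥-elim ∘ k∉A) (⊥-elim ∘ j′∉A)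
  ... | no  i∉A | yes _   | no  j′∉A = StarAtJ.single-leaf star (⊥-elim ∘ i∉A) (λ _ → refl) (⊥-elim ∘ j′∉A)
  ... | no  i∉A | no  k∉A | _        = StarAtJ.single-leaf star (⊥-elim ∘ i∉A) (⊥-elim ∘ k∉A) (λ _ → refl)

  data Shape (A : Sub (suc n)) (c : Fin n) : Set where
    avoids-j   : j ∉ proj₁ A → Shape A c
    contains-j : ∀ {f} → NewEdge c f → j ∈ proj₁ A → ι f ∉ proj₁ A → Shape A c

  other-endpoint : ∀ {c} → ι c ~ j → ∃ λ f → NewEdge c f
  other-endpoint c~j with N[j]⊆ik c~j
  ... | inj₁ c≡i = k′ , inj₁ (c≡i , ι-k′)
  ... | inj₂ c≡k = i′ , inj₂ (c≡k , ι-i′)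

  kept-shape : ∀ A → Kept′ A → ∃ λ c → StarT A (inj₁ (ι c)) × j ∉ proj₂ A × Shape A c
  kept-shape A (((inj₂ v , star) , _) , _) = ⊥-elim (¬star-at-primed star)
  kept-shape A kept@(((inj₁ w , star) , _) , _) with w ≟ j
  ... | yes refl = ⊥-elim (¬kept-star-at-j A kept star)
  ... | no  w≢j with c , refl ← ι-onto w≢j = c , star , j′∉A , shape (j ∈? proj₁ A)
    where
    adjacent : ∀ a → a ∈A A → a ≢ inj₁ (ι c) → AugAdj adjT I J (inj₁ (ι c)) a
    adjacent = proj₁ (proj₂ star)

    j′∉A : j ∉ proj₂ A
    j′∉A j′∈A = ι≢j c (proj₁ (adjacent (inj₂ j) j′∈A λ ()))

    shape : Dec (j ∈ proj₁ A) → Shape A c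
    shape (no j∉A) = avoids-j j∉A
    shape (yes j∈A) with f , new ← other-endpoint (adjacent (inj₁ j) j∈A (ι≢j c ∘ sym ∘ inj₁-injective)) =
      contains-j new j∈A λ f∈A → NewEdge⇒¬~ new (adjacent (inj₁ (ι f)) f∈A f≢c)
      where
      f≢c : inj₁ (ι f) ≢ inj₁ (ι c)
      f≢c e = NewEdge-irrefl (subst (NewEdge c) (ι-injective (inj₁-injective e)) new)

  ιSub : Sub n → Sub (suc n)
  ιSub (B₁ , B₂) = insertAt B₁ j outside , insertAt B₂ j outside

  ∈ιSub⇔ : ∀ B a → ιA a ∈A ιSub B ⇔ a ∈A B
  ∈ιSub⇔ (B₁ , B₂) (inj₁ u) = mk⇔
    (λ h → lookup⇒∈ (trans (sym (insertAt-punchIn B₁ j outside u)) ([]=⇒lookup h)))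
    (λ h → lookup⇒∈ (trans (insertAt-punchIn B₁ j outside u) ([]=⇒lookup h)))
  ∈ιSub⇔ (B₁ , B₂) (inj₂ u) = mk⇔
    (λ h → lookup⇒∈ (trans (sym (insertAt-punchIn B₂ j outside u)) ([]=⇒lookup h)))
    (λ h → lookup⇒∈ (trans (insertAt-punchIn B₂ j outside u) ([]=⇒lookup h)))

  j∉ιSub : ∀ B → j ∉ proj₁ (ιSub B) × j ∉ proj₂ (ιSub B)
  j∉ιSub (B₁ , B₂) = j∉insertAt B₁ j , j∉insertAt B₂ j

  ιSub-onto : ∀ B {b} → b ∈A ιSub B → ∃ λ a → ιA a ≡ b
  ιSub-onto B b∈B = ιA-onto (λ { refl → proj₁ (j∉ιSub B) b∈B }) (λ { refl → proj₂ (j∉ιSub B) b∈B })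

  relabel-ιSub : ∀ B → R (ιSub B) ≡ B
  relabel-ιSub (B₁ , B₂) rewrite insertAt-lookup B₁ j outside =
    cong₂ _,_ (removeAt-insertAt B₁ j outside) (removeAt-insertAt B₂ j outside)

  ιSub-injective : ∀ {B B′} → ιSub B ≡ ιSub B′ → B ≡ B′
  ιSub-injective {B} {B′} e = trans (sym (relabel-ιSub B)) (trans (cong R e) (relabel-ιSub B′))

  ιSub-relabel : ∀ {A} → j ∉ proj₁ A → j ∉ proj₂ A → ιSub (R A) ≡ A
  ιSub-relabel {A₁ , A₂} j∉A₁ j∉A₂ with lookup A₁ j in j∈?A₁ | lookup A₂ j in j∈?A₂
  ... | true  | _     = ⊥-elim (j∉A₁ (lookup⇒∈ j∈?A₁))
  ... | false | true  = ⊥-elim (j∉A₂ (lookup⇒∈ j∈?A₂))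
  ... | false | false = cong₂ _,_ (reinsert A₁ j∈?A₁) (reinsert A₂ j∈?A₂)
    where
    reinsert : ∀ xs → lookup xs j ≡ outside → insertAt (removeAt xs j) j outside ≡ xs
    reinsert xs e = trans (cong (insertAt (removeAt xs j) j) (sym e)) (insertAt-removeAt xs j)

  ιSub-⁅⁆ : ∀ a w b → ιSub (⁅ a ⁆ ∪ ⁅ w ⁆ ∪ ⁅ b ⁆ , ∅) ≡ (⁅ ι a ⁆ ∪ ⁅ ι w ⁆ ∪ ⁅ ι b ⁆ , ∅)
  ιSub-⁅⁆ a w b = cong₂ _,_ (insertAt-⁅x⁆∪⁅y⁆∪⁅z⁆ j a w b) (insertAt-∅ j)

  ιSub-⁅⁆′ : ∀ a w b → ιSub (⁅ a ⁆ ∪ ⁅ w ⁆ ∪ ⁅ b ⁆ , ⁅ w ⁆) ≡ (⁅ ι a ⁆ ∪ ⁅ ι w ⁆ ∪ ⁅ ι b ⁆ , ⁅ ι w ⁆)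
  ιSub-⁅⁆′ a w b = cong₂ _,_ (insertAt-⁅x⁆∪⁅y⁆∪⁅z⁆ j a w b) (insertAt-⁅⁆ j w)

  Omitted-ιSub⁺ : ∀ {B} → Omitted adjX IX JX B → Omitted adjT I J (ιSub B)
  Omitted-ιSub⁺ (w , w∈JX , a , b , N[w] , B≡) =
    ι w , ∈J-ι⁺ w∈JX , ι a , ι b , Nbhd2-ι⁺ w∈JX N[w] ,
    Sum.map (λ e → trans (cong ιSub e) (ιSub-⁅⁆ a w b)) (λ e → trans (cong ιSub e) (ιSub-⁅⁆′ a w b)) B≡

  ∈ιSub⇒≢j : ∀ B {u} → u ∈ proj₁ (ιSub B) → u ≢ j
  ∈ιSub⇒≢j B u∈B refl = proj₁ (j∉ιSub B) u∈B

  Omitted-ιSub⁻ : ∀ {B} → Omitted adjT I J (ιSub B) → Omitted adjX IX JX B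
  Omitted-ιSub⁻ {B} (w , w∈J , a , b , N[w]@(_ , a~w , b~w , _) , B≡)
    with w′ , refl ← ι-onto (∈ιSub⇒≢j B (subst (w ∈_) (sym ([ cong proj₁ , cong proj₁ ]′ B≡))
                                                   (∈⁅x⁆∪⁅y⁆∪⁅z⁆⁺ (inj₂ (inj₁ refl)))))
       | a′ , refl ← ι-onto (J-neighbour≢j w∈J a~w)
       | b′ , refl ← ι-onto (J-neighbour≢j w∈J b~w) =
    w′ , ∈J-ι⁻ w∈J , a′ , b′ , Nbhd2-ι⁻ w∈J N[w] ,
    Sum.map (λ e → ιSub-injective (trans e (sym (ιSub-⁅⁆ a′ w′ b′))))
                 (λ e → ιSub-injective (trans e (sym (ιSub-⁅⁆′ a′ w′ b′)))) B≡

  NewEdge⇒∉J : ∀ {u v} → NewEdge u v → ι u ∉ J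
  NewEdge⇒∉J new u∈J = N[j]∉IJ (NewEdge⇒~j new) (inj₂ u∈J)

  NewEdge-endpoints : ∀ {c f} → NewEdge c f → Endpoint (inj₁ c) × Endpoint (inj₁ f)
  NewEdge-endpoints (inj₁ (c≡i , f≡k)) = inj₁ c≡i , inj₂ f≡k
  NewEdge-endpoints (inj₂ (c≡k , f≡i)) = inj₂ c≡k , inj₁ f≡i

  NewEdge-endpoint : ∀ {c f u} → NewEdge c f → Endpoint (inj₁ u) → u ≡ c ⊎ NewEdge c u
  NewEdge-endpoint (inj₁ (c≡i , _)) (inj₁ u≡i) = inj₁ (ι-injective (trans u≡i (sym c≡i)))
  NewEdge-endpoint (inj₁ (c≡i , _)) (inj₂ u≡k) = inj₂ (inj₁ (c≡i , u≡k))
  NewEdge-endpoint (inj₂ (c≡k , _)) (inj₁ u≡i) = inj₂ (inj₂ (c≡k , u≡i))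
  NewEdge-endpoint (inj₂ (c≡k , _)) (inj₂ u≡k) = inj₁ (ι-injective (trans u≡k (sym c≡k)))

  ∈-relabel-avoiding : ∀ {A} → j ∉ proj₁ A → ∀ a → a ∈A R A → ιA a ∈A A
  ∈-relabel-avoiding {A} j∉A a h = [ id , ⊥-elim ∘ j∉A ∘ proj₁ ]′ (∈-relabel⁻ A a h)

  endpoints∈relabel : ∀ {A c f} → j ∈ proj₁ A → NewEdge c f → c ∈ proj₁ (R A) × f ∈ proj₁ (R A)
  endpoints∈relabel {A} j∈A new =
    ∈-relabel⁺ A (inj₁ _) (inj₂ (j∈A , proj₁ (NewEdge-endpoints new))) ,
    ∈-relabel⁺ A (inj₁ _) (inj₂ (j∈A , proj₂ (NewEdge-endpoints new)))

  relabel-star-avoiding : ∀ {A c} → StarT A (inj₁ (ι c)) → j ∉ proj₁ A → j ∉ proj₂ A →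
                          StarX (R A) (inj₁ c)
  relabel-star-avoiding {A} {c} (c∈A , adjacent , 3≤∣A∣) j∉A j′∉A =
    ∈-relabel⁺ A (inj₁ c) (inj₁ c∈A) ,
    (λ a a∈RA a≢c →
       AugAdj-ι⁻ (inj₁ c) a (adjacent (ιA a) (∈-relabel-avoiding j∉A a a∈RA) (a≢c ∘ ιA-injective))) ,
    3≤card-transfer (λ a b → ιA a ≡ b) (λ e e′ → trans (sym e) e′) represented {inj₁ (ι c)} c∈A 3≤∣A∣
    where
    represented : ∀ b → b ∈A A → ∃ λ a → a ∈A R A × ιA a ≡ b
    represented b b∈A with a , refl ← ιA-onto {b} (λ { refl → j∉A b∈A }) (λ { refl → j′∉A b∈A }) =
      a , ∈-relabel⁺ A a (inj₁ b∈A) , refl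

  relabel-star-containing : ∀ {A c f} → StarT A (inj₁ (ι c)) → NewEdge c f →
                            j ∈ proj₁ A → ι f ∉ proj₁ A → j ∉ proj₂ A → StarX (R A) (inj₁ c)
  relabel-star-containing {A} {c} {f} (_ , adjacent , 3≤∣A∣) new j∈A f∉A j′∉A =
    c∈RA , adjacent′ , 3≤card
    where
    c∈RA : c ∈ proj₁ (R A)
    c∈RA = proj₁ (endpoints∈relabel {A} j∈A new)
    f∈RA : f ∈ proj₁ (R A)
    f∈RA = proj₂ (endpoints∈relabel {A} j∈A new)

    adjacent′ : ∀ a → a ∈A R A → a ≢ inj₁ c → AugAdj adjX IX JX (inj₁ c) a
    adjacent′ a a∈RA a≢c with ∈-relabel⁻ A a a∈RA
    ... | inj₁ a∈A = AugAdj-ι⁻ (inj₁ c) a (adjacent (ιA a) a∈A (a≢c ∘ ιA-injective))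
    adjacent′ (inj₁ u) _ a≢c | inj₂ (_ , endpoint) with NewEdge-endpoint new endpoint
    ... | inj₁ refl = ⊥-elim (a≢c refl)
    ... | inj₂ new′ = ~ˣ-new new′

    3≤card : 3 ≤ card (R A)
    3≤card with b , b∈A , b≢c , b≢j ← 3≤card⇒fresh A 3≤∣A∣ (inj₁ (ι c)) (inj₁ j)
           with a , refl ← ιA-onto {b} b≢j (λ { refl → j′∉A b∈A }) =
      distinct⇒3≤card c∈RA f∈RA (∈-relabel⁺ A a (inj₁ b∈A))
        (λ c≡f → NewEdge-irrefl (subst (NewEdge c) (sym (inj₁-injective c≡f)) new))
        (λ { refl → b≢c refl })
        (λ { refl → f∉A b∈A })

  -- The endpoints of the new edge are not in J, so they would be two adjacent leaves of the
  -- omitted coordinate.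
  ¬omitted-with-new-edge : ∀ {B c f} → NewEdge c f → c ∈ proj₁ B → f ∈ proj₁ B → ¬ Omitted adjX IX JX B
  ¬omitted-with-new-edge {c = c} {f} new c∈B f∈B om with w , w∈JX , leaf~w , _ ← Omitted⇒centre {adj = adjX} {IX} om =
    X-triangleFree c f w (~ˣ-new new)
      (leaf~w f∈B λ { refl → NewEdge⇒∉J (NewEdge-sym new) (∈J-ι⁺ w∈JX) })
      (leaf~w c∈B λ { refl → NewEdge⇒∉J new (∈J-ι⁺ w∈JX) })

  relabel-coord : ∀ A → Kept′ A → Coord adjX IX JX (R A)
  relabel-coord A kept@((_ , ¬omitted) , _) with kept-shape A kept
  ... | c , star , j′∉A , avoids-j j∉A =
    (inj₁ c , relabel-star-avoiding star j∉A j′∉A) ,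
    λ om → ¬omitted (subst (Omitted adjT I J) (ιSub-relabel j∉A j′∉A) (Omitted-ιSub⁺ om))
  ... | c , star , j′∉A , contains-j new j∈A f∉A =
    (inj₁ c , relabel-star-containing star new j∈A f∉A j′∉A) ,
    ¬omitted-with-new-edge new (proj₁ (endpoints∈relabel {A} j∈A new)) (proj₂ (endpoints∈relabel {A} j∈A new))

  NewEdgeA-unique : ∀ {c f a} → NewEdge c f → NewEdgeA (inj₁ c) a → a ≡ inj₁ f
  NewEdgeA-unique {a = inj₁ u} new new′ = cong inj₁ (NewEdge-unique new′ new)

  ≢-primed-j : ∀ {A : Sub (suc n)} {S} → j ∉ proj₂ A → A ≢ (S , ⁅ j ⁆)
  ≢-primed-j j′∉A refl = j′∉A (x∈⁅x⁆ j)

  NewEdge⇒i′k′ : ∀ {B : Subset n} {u v} → NewEdge u v → u ∈ B → v ∈ B → i′ ∈ B × k′ ∈ B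
  NewEdge⇒i′k′ {B} (inj₁ (u≡i , v≡k)) u∈B v∈B =
    subst (_∈ B) (ι-injective (trans u≡i (sym ι-i′))) u∈B , subst (_∈ B) (ι-injective (trans v≡k (sym ι-k′))) v∈B
  NewEdge⇒i′k′ {B} (inj₂ (u≡k , v≡i)) u∈B v∈B =
    subst (_∈ B) (ι-injective (trans v≡i (sym ι-i′))) v∈B , subst (_∈ B) (ι-injective (trans u≡k (sym ι-k′))) u∈B

  ιSub-kept : ∀ {B c} → StarX B c → ¬ Omitted adjX IX JX B → ¬ (i′ ∈ proj₁ B × k′ ∈ proj₁ B) →
              Kept′ (ιSub B)
  ιSub-kept {B} {c} (c∈B , adjacent , 3≤∣B∣) ¬omitted ¬i′k′ =
    ((ιA c , star) , ¬omitted ∘ Omitted-ιSub⁻) , ≢-primed-j j′∉A , ≢-primed-j j′∉A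
    where
    j′∉A : j ∉ proj₂ (ιSub B)
    j′∉A = proj₂ (j∉ιSub B)

    adjacent′ : ∀ b → b ∈A ιSub B → b ≢ ιA c → AugAdj adjT I J (ιA c) b
    adjacent′ b b∈A b≢c with a , refl ← ιSub-onto B b∈A
                        with a∈B ← to (∈ιSub⇔ B a) b∈A
                        with AugAdj-ι⁺ c a (adjacent a a∈B (b≢c ∘ cong ιA))
    ... | inj₁ old = old
    ... | inj₂ new = ⊥-elim (¬i′k′ (both c a new c∈B a∈B))
      where
      both : ∀ c a → NewEdgeA c a → c ∈A B → a ∈A B → i′ ∈ proj₁ B × k′ ∈ proj₁ B
      both (inj₁ u) (inj₁ v) new = NewEdge⇒i′k′ new

    star : StarT (ιSub B) (ιA c)
    star = from (∈ιSub⇔ B c) c∈B , adjacent′ ,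
           3≤card-transfer (λ a b → ιA b ≡ a) (λ e e′ → ιA-injective (trans e (sym e′)))
             (λ b b∈B → ιA b , from (∈ιSub⇔ B b) b∈B , refl) c∈B 3≤∣B∣

  -- The kept coordinate relabelled to B when B contains the new edge c – f and is centred at c:
  -- j takes the place of f.
  ιSubʲ : Fin n → Sub n → Sub (suc n)
  ιSubʲ f (B₁ , B₂) = insertAt B₁ j inside ∖ ι f , insertAt B₂ j outside

  module _ {f : Fin n} {B : Sub n} where

    j∈ιSubʲ : j ∈ proj₁ (ιSubʲ f B)
    j∈ιSubʲ = lookup⇒∈ (trans (lookup∘update′ (ι≢j f ∘ sym) (insertAt (proj₁ B) j inside) outside) (insertAt-lookup (proj₁ B) j inside))

    f∉ιSubʲ : ι f ∉ proj₁ (ιSubʲ f B)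
    f∉ιSubʲ = x∉p∖x (insertAt (proj₁ B) j inside) (ι f)

    j′∉ιSubʲ : j ∉ proj₂ (ιSubʲ f B)
    j′∉ιSubʲ = j∉insertAt (proj₂ B) j

    ∈ιSubʲ⇔ : ∀ a → a ≢ inj₁ f → ιA a ∈A ιSubʲ f B ⇔ a ∈A B
    ∈ιSubʲ⇔ (inj₁ u) u≢f = mk⇔
      (λ h → lookup⇒∈ (trans (sym lookup-u) ([]=⇒lookup h)))
      (λ h → lookup⇒∈ (trans lookup-u ([]=⇒lookup h)))
      where
      lookup-u : lookup (proj₁ (ιSubʲ f B)) (ι u) ≡ lookup (proj₁ B) u
      lookup-u = trans (lookup∘update′ (u≢f ∘ cong inj₁ ∘ ι-injective) (insertAt (proj₁ B) j inside) outside)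
                       (insertAt-punchIn (proj₁ B) j inside u)
    ∈ιSubʲ⇔ (inj₂ u) _ = mk⇔
      (λ h → lookup⇒∈ (trans (sym (insertAt-punchIn (proj₂ B) j outside u)) ([]=⇒lookup h)))
      (λ h → lookup⇒∈ (trans (insertAt-punchIn (proj₂ B) j outside u) ([]=⇒lookup h)))

    ιSubʲ-onto : ∀ {b} → b ∈A ιSubʲ f B → b ≢ inj₁ j → ∃ λ a → ιA a ≡ b × a ≢ inj₁ f
    ιSubʲ-onto {b} b∈A b≢j with a , refl ← ιA-onto {b} b≢j (λ { refl → j′∉ιSubʲ b∈A }) =
      a , refl , λ { refl → f∉ιSubʲ b∈A }

    relabel-ιSubʲ : ∀ {c} → NewEdge c f → c ∈ proj₁ B → f ∈ proj₁ B → R (ιSubʲ f B) ≡ B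
    relabel-ιSubʲ new c∈B f∈B = Sub-ext
      (λ a a∈RA → [ (λ a∈A → to (∈ιSubʲ⇔ a (λ { refl → f∉ιSubʲ a∈A })) a∈A) , endpoint∈B a ∘ proj₂ ]′
                   (∈-relabel⁻ (ιSubʲ f B) a a∈RA))
      (λ a a∈B → ∈-relabel⁺ (ιSubʲ f B) a (lifted a a∈B))
      where
      endpoint∈B : ∀ a → Endpoint a → a ∈A B
      endpoint∈B (inj₁ u) endpoint with NewEdge-endpoint new endpoint
      ... | inj₁ refl = c∈B
      ... | inj₂ new′ = subst (_∈ proj₁ B) (NewEdge-unique new new′) f∈B

      lifted : ∀ a → a ∈A B → ιA a ∈A ιSubʲ f B ⊎ (j ∈ proj₁ (ιSubʲ f B) × Endpoint a)
      lifted a a∈B with a ≟A inj₁ f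
      ... | yes refl = inj₂ (j∈ιSubʲ , proj₂ (NewEdge-endpoints new))
      ... | no  a≢f  = inj₁ (from (∈ιSubʲ⇔ a a≢f) a∈B)

    ιSubʲ-star : ∀ {c} → StarX B (inj₁ c) → NewEdge c f → StarT (ιSubʲ f B) (inj₁ (ι c))
    ιSubʲ-star {c} (c∈B , adjacent , 3≤∣B∣) new = c∈A , adjacent′ , 3≤card
      where
      c≢f : inj₁ c ≢ inj₁ f
      c≢f e = NewEdge-irrefl (subst (NewEdge c) (sym (inj₁-injective e)) new)

      c∈A : ι c ∈ proj₁ (ιSubʲ f B)
      c∈A = from (∈ιSubʲ⇔ (inj₁ c) c≢f) c∈B

      adjacent′ : ∀ b → b ∈A ιSubʲ f B → b ≢ inj₁ (ι c) → AugAdj adjT I J (inj₁ (ι c)) b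
      adjacent′ b b∈A b≢c with b ≟A inj₁ j
      ... | yes refl = NewEdge⇒~j new
      ... | no  b≢j with a , refl , a≢f ← ιSubʲ-onto b∈A b≢j =
        [ id , (λ new′ → ⊥-elim (a≢f (NewEdgeA-unique new new′))) ]′
          (AugAdj-ι⁺ (inj₁ c) a (adjacent a (to (∈ιSubʲ⇔ a a≢f) b∈A) (b≢c ∘ cong ιA)))

      lift≢j : ∀ b → ιA b ≢ inj₁ j
      lift≢j (inj₁ u) e = ι≢j u (inj₁-injective e)

      3≤card : 3 ≤ card (ιSubʲ f B)
      3≤card with b , b∈B , b≢c , b≢f ← 3≤card⇒fresh B 3≤∣B∣ (inj₁ c) (inj₁ f) =
        distinct⇒3≤card c∈A j∈ιSubʲ (from (∈ιSubʲ⇔ b b≢f) b∈B)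
          (ι≢j c ∘ inj₁-injective) (b≢c ∘ sym ∘ ιA-injective) (λ j≡b → lift≢j b (sym j≡b))

    -- The centre of an omitted coordinate is in J, so it must be j itself; but then the
    -- omitted coordinate contains both neighbours of j, including ι f.
    ¬omitted-ιSubʲ : ι f ~ j → ¬ Omitted adjT I J (ιSubʲ f B)
    ¬omitted-ιSubʲ f~j om with w , w∈J , leaf~w , N[w]⊆A ← Omitted⇒centre {adj = adjT} {I} om
                         with j ≟ w
    ... | no  j≢w  = J-nonadjacent j∈J w∈J (leaf~w j∈ιSubʲ j≢w)
    ... | yes refl = f∉ιSubʲ (N[w]⊆A f~j)

    ιSubʲ-kept : ∀ {c} → StarX B (inj₁ c) → NewEdge c f → Kept′ (ιSubʲ f B)
    ιSubʲ-kept star new =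
      ((_ , ιSubʲ-star star new) , ¬omitted-ιSubʲ (NewEdge⇒~j (NewEdge-sym new))) ,
      ≢-primed-j j′∉ιSubʲ , ≢-primed-j j′∉ιSubʲ

  -- Only an endpoint of the new edge can be the centre of a star containing both endpoints,
  -- since the augmented graph of X is triangle-free.
  endpoint-centre : ∀ {B c₀} → StarX B c₀ → i′ ∈ proj₁ B → k′ ∈ proj₁ B →
                    ∃ λ c → ∃ λ f → c₀ ≡ inj₁ c × NewEdge c f × f ∈ proj₁ B
  endpoint-centre {c₀ = c₀} (_ , adjacent , _) i′∈B k′∈B with c₀ ≟A inj₁ i′ | c₀ ≟A inj₁ k′
  ... | yes refl | _        = i′ , k′ , refl , inj₁ (ι-i′ , ι-k′) , k′∈B
  ... | no _     | yes refl = k′ , i′ , refl , inj₂ (ι-k′ , ι-i′) , i′∈B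
  ... | no c≢i′  | no c≢k′  = ⊥-elim (AugX.AugAdj-triangleFree c₀ (inj₁ i′) (inj₁ k′)
                                (adjacent _ i′∈B (c≢i′ ∘ sym)) (~ˣ-new (inj₁ (ι-i′ , ι-k′)))
                                (adjacent _ k′∈B (c≢k′ ∘ sym)))

  relabel-onto : ∀ B → Coord adjX IX JX B → ∃ λ A → Kept′ A × R A ≡ B
  relabel-onto B ((_ , star) , ¬omitted) with i′ ∈? proj₁ B | k′ ∈? proj₁ B
  ... | yes i′∈B | yes k′∈B with c , f , refl , new , f∈B ← endpoint-centre star i′∈B k′∈B =
    ιSubʲ f B , ιSubʲ-kept star new , relabel-ιSubʲ new (proj₁ star) f∈B
  ... | no i′∉B  | _        = ιSub B , ιSub-kept star ¬omitted (i′∉B ∘ proj₁) , relabel-ιSub B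
  ... | yes _    | no k′∉B  = ιSub B , ιSub-kept star ¬omitted (k′∉B ∘ proj₂) , relabel-ιSub B

  -- Corresponding orientations of T and X

  -- D and DX agree away from j, and D orients the path i – j – k as DX orients the edge i – k.
  record Compatible (D : Fin (suc n) → Fin (suc n) → Bool) (DX : Fin n → Fin n → Bool) : Set where
    field
      D⊆T     : ArcsAreEdges tree D
      DX⊆X    : ArcsAreEdges X DX
      old-arc : ∀ {u v} → ι u ~ ι v → Arc D (ι u) (ι v) ⇔ Arc DX u v
      new-arc : ∀ {u v} → NewEdge u v → Arc D j (ι v) ⇔ Arc DX u v

  module _ {D DX} (compatible : Compatible D DX) where
    open Compatible compatible

    AugPar-ι : ∀ a b → AugAdj adjT I J (ιA a) (ιA b) → AugPar I J D (ιA a) (ιA b) ⇔ AugPar IX JX DX a b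
    AugPar-ι (inj₁ u) (inj₁ v) u~v = old-arc u~v
    AugPar-ι (inj₁ u) (inj₂ v) _   = mk⇔ (λ ()) (λ ())
    AugPar-ι (inj₂ u) (inj₁ v) _   =
      mk⇔ (λ (e , u∈IJ) → ι-injective e , IJ-ι⁻ u∈IJ) (λ (e , u∈IJ) → cong ι e , IJ-ι⁺ u∈IJ)
    AugPar-ι (inj₂ u) (inj₂ v) _   = mk⇔ (λ ()) (λ ())

    sink-avoiding : ∀ {A c} → StarT A (inj₁ (ι c)) → j ∉ proj₁ A → j ∉ proj₂ A →
                    IsSink I J D A (inj₁ (ι c)) ⇔ IsSink IX JX DX (R A) (inj₁ c)
    sink-avoiding {A} {c} (_ , adjacent , _) j∉A j′∉A = mk⇔ sinkX sinkT
      where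
      parent : ∀ a → ιA a ∈A A → a ≢ inj₁ c → AugPar I J D (ιA a) (inj₁ (ι c)) ⇔ AugPar IX JX DX a (inj₁ c)
      parent a a∈A a≢c = AugPar-ι a (inj₁ c) (AugT.AugAdj-sym (inj₁ (ι c)) (ιA a) (adjacent (ιA a) a∈A (a≢c ∘ ιA-injective)))

      sinkX : IsSink I J D A (inj₁ (ι c)) → IsSink IX JX DX (R A) (inj₁ c)
      sinkX sink a a∈RA a≢c = to (parent a a∈A a≢c) (sink (ιA a) a∈A (a≢c ∘ ιA-injective))
        where
        a∈A : ιA a ∈A A
        a∈A = ∈-relabel-avoiding j∉A a a∈RA

      sinkT : IsSink IX JX DX (R A) (inj₁ c) → IsSink I J D A (inj₁ (ι c))
      sinkT sink b b∈A b≢c with a , refl ← ιA-onto {b} (λ { refl → j∉A b∈A }) (λ { refl → j′∉A b∈A }) =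
        from (parent a b∈A (b≢c ∘ cong ιA)) (sink a (∈-relabel⁺ A a (inj₁ b∈A)) (b≢c ∘ cong ιA))

    sink-containing : ∀ {A c f} → StarT A (inj₁ (ι c)) → NewEdge c f → j ∈ proj₁ A → j ∉ proj₂ A →
                      IsSink I J D A (inj₁ (ι c)) ⇔ IsSink IX JX DX (R A) (inj₁ c)
    sink-containing {A} {c} {f} (_ , adjacent , _) new j∈A j′∉A = mk⇔ sinkX sinkT
      where
      parent : ∀ a → ιA a ∈A A → a ≢ inj₁ c → AugPar I J D (ιA a) (inj₁ (ι c)) ⇔ AugPar IX JX DX a (inj₁ c)
      parent a a∈A a≢c = AugPar-ι a (inj₁ c) (AugT.AugAdj-sym (inj₁ (ι c)) (ιA a) (adjacent (ιA a) a∈A (a≢c ∘ ιA-injective)))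

      j≢c : inj₁ j ≢ inj₁ (ι c)
      j≢c e = ι≢j c (sym (inj₁-injective e))

      sinkX : IsSink I J D A (inj₁ (ι c)) → IsSink IX JX DX (R A) (inj₁ c)
      sinkX sink a a∈RA a≢c with ∈-relabel⁻ A a a∈RA
      ... | inj₁ a∈A = to (parent a a∈A a≢c) (sink (ιA a) a∈A (a≢c ∘ ιA-injective))
      sinkX sink (inj₁ u) _ a≢c | inj₂ (_ , endpoint) with NewEdge-endpoint new endpoint
      ... | inj₁ refl = ⊥-elim (a≢c refl)
      ... | inj₂ new′ = to (new-arc (NewEdge-sym new′)) (sink (inj₁ j) j∈A j≢c)

      sinkT : IsSink IX JX DX (R A) (inj₁ c) → IsSink I J D A (inj₁ (ι c))
      sinkT sink b b∈A b≢c with b ≟A inj₁ j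
      ... | yes refl = from (new-arc (NewEdge-sym new))
                         (sink (inj₁ f) (proj₂ (endpoints∈relabel {A} j∈A new)) (c≢f ∘ sym))
        where
        c≢f : inj₁ c ≢ inj₁ f
        c≢f e = NewEdge-irrefl (subst (NewEdge c) (sym (inj₁-injective e)) new)
      ... | no  b≢j with a , refl ← ιA-onto {b} b≢j (λ { refl → j′∉A b∈A }) =
        from (parent a b∈A (b≢c ∘ cong ιA)) (sink a (∈-relabel⁺ A a (inj₁ b∈A)) (b≢c ∘ cong ιA))

    CCond-relabel : ∀ A → Kept′ A → CCond I J D A ⇔ CCond IX JX DX (R A)
    CCond-relabel A kept with kept-shape A kept
    ... | c , star , j′∉A , avoids-j j∉A =
      ⇔-sym (AugX.CCond⇔centre-is-sink DX⊆X (relabel-star-avoiding star j∉A j′∉A))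
        ⇔-∘ (sink-avoiding star j∉A j′∉A ⇔-∘ AugT.CCond⇔centre-is-sink D⊆T star)
    ... | c , star , j′∉A , contains-j new j∈A f∉A =
      ⇔-sym (AugX.CCond⇔centre-is-sink DX⊆X (relabel-star-containing star new j∈A f∉A j′∉A))
        ⇔-∘ (sink-containing star new j∈A j′∉A ⇔-∘ AugT.CCond⇔centre-is-sink D⊆T star)

  neighbours-of-j⇒NewEdge : ∀ {u v} → u ≢ v → ι u ~ j → ι v ~ j → NewEdge u v
  neighbours-of-j⇒NewEdge u≢v u~j v~j with N[j]⊆ik u~j | N[j]⊆ik v~j
  ... | inj₁ u≡i | inj₂ v≡k = inj₁ (u≡i , v≡k)
  ... | inj₂ u≡k | inj₁ v≡i = inj₂ (u≡k , v≡i)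
  ... | inj₁ u≡i | inj₁ v≡i = ⊥-elim (u≢v (ι-injective (trans u≡i (sym v≡i))))
  ... | inj₂ u≡k | inj₂ v≡k = ⊥-elim (u≢v (ι-injective (trans u≡k (sym v≡k))))

  NewEdge⇒ι≢ : ∀ {u v} → NewEdge u v → ι u ≢ ι v
  NewEdge⇒ι≢ {u} new e = NewEdge-irrefl (subst (NewEdge u) (sym (ι-injective e)) new)

  module Contract {D : Fin (suc n) → Fin (suc n) → Bool} (admissible : Admissible adjT J D) where

    D⊆T : ArcsAreEdges tree D
    D⊆T = proj₁ (proj₁ admissible)

    D-total : ∀ u v → u ~ v → Arc D u v ⊎ Arc D v u
    D-total = proj₁ (proj₂ (proj₁ admissible))

    D-acyclic : ∀ v → ¬ TransClosure (Arc D) v v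
    D-acyclic = proj₂ (proj₂ (proj₁ admissible))

    D-asym : ∀ {u v} → Arc D u v → Arc D v u → ⊥
    D-asym {u} uv vu = D-acyclic u (uv ∷ ⟪ vu ⟫)

    into-j : ∀ {a b} → a ≢ b → a ~ j → b ~ j → Arc D j b → Arc D a j
    into-j {a} {b} a≢b a~j b~j jb with proj₂ admissible j j∈J a b a≢b a~j b~j
    ... | inj₁ (aj , _) = aj
    ... | inj₂ (bj , _) = ⊥-elim (D-asym jb bj)

    DX : Fin n → Fin n → Bool
    DX u v = D (ι u) (ι v) ∨ (D (ι u) j ∧ D j (ι v))

    DX-view : ∀ {u v} → Arc DX u v → Arc D (ι u) (ι v) ⊎ (Arc D (ι u) j × Arc D j (ι v))
    DX-view h = Sum.map₂ (to T-∧) (to T-∨ h)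

    DX-old : ∀ {u v} → Arc D (ι u) (ι v) → Arc DX u v
    DX-old h = from T-∨ (inj₁ h)

    DX-via-j : ∀ {u v} → Arc D (ι u) j → Arc D j (ι v) → Arc DX u v
    DX-via-j {u} {v} uj jv = from (T-∨ {D (ι u) (ι v)}) (inj₂ (from T-∧ (uj , jv)))

    via-j⇒NewEdge : ∀ {u v} → Arc D (ι u) j → Arc D j (ι v) → NewEdge u v
    via-j⇒NewEdge uj jv = neighbours-of-j⇒NewEdge (λ { refl → D-asym uj jv })
                            (D⊆T _ _ uj) (~-sym (D⊆T _ _ jv))

    DX⊆X : ArcsAreEdges X DX
    DX⊆X u v h = [ ~ˣ-old ∘ D⊆T _ _ , (λ (uj , jv) → ~ˣ-new (via-j⇒NewEdge uj jv)) ]′ (DX-view h)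

    DX-total : ∀ u v → u ~ˣ v → Arc DX u v ⊎ Arc DX v u
    DX-total u v u~v with ~ˣ-view u~v
    ... | inj₁ old = Sum.map DX-old DX-old (D-total _ _ old)
    ... | inj₂ new with proj₂ admissible j j∈J (ι u) (ι v) (NewEdge⇒ι≢ new)
                          (NewEdge⇒~j new) (NewEdge⇒~j (NewEdge-sym new))
    ...   | inj₁ (uj , jv) = inj₁ (DX-via-j uj jv)
    ...   | inj₂ (vj , ju) = inj₂ (DX-via-j vj ju)

    lift-arc : ∀ {u v} → Arc DX u v → TransClosure (Arc D) (ι u) (ι v)
    lift-arc h = [ ⟪_⟫ , (λ (uj , jv) → uj ∷ ⟪ jv ⟫) ]′ (DX-view h)

    lift-path : ∀ {u v} → TransClosure (Arc DX) u v → TransClosure (Arc D) (ι u) (ι v)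
    lift-path ⟪ h ⟫  = lift-arc h
    lift-path (h ∷ p) = lift-arc h ++ lift-path p

    DX-J : ∀ w → w ∈ JX → ∀ a b → a ≢ b → a ~ˣ w → b ~ˣ w →
           (Arc DX a w × Arc DX w b) ⊎ (Arc DX b w × Arc DX w a)
    DX-J w w∈JX a b a≢b a~w b~w =
      Sum.map (Product.map DX-old DX-old) (Product.map DX-old DX-old)
        (proj₂ admissible (ι w) (∈J-ι⁺ w∈JX) (ι a) (ι b) (a≢b ∘ ι-injective)
          (JX-edge-old w∈JX a~w) (JX-edge-old w∈JX b~w))

    DX-admissible : Admissible adjX JX DX
    DX-admissible = (DX⊆X , DX-total , λ v → D-acyclic (ι v) ∘ lift-path) , DX-J

    compatible : Compatible D DX
    compatible = record
      { D⊆T     = D⊆T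
      ; DX⊆X    = DX⊆X
      ; old-arc = λ u~v → mk⇔ DX-old λ h →
          [ id , (λ (uj , jv) → ⊥-elim (triangle-free _ j _ (D⊆T _ _ uj) (D⊆T _ _ jv) u~v)) ]′
            (DX-view h)
      ; new-arc = λ new → mk⇔
          (λ jv → DX-via-j (into-j (NewEdge⇒ι≢ new) (NewEdge⇒~j new) (NewEdge⇒~j (NewEdge-sym new)) jv) jv)
          (λ h → [ (λ old → ⊥-elim (NewEdge⇒¬~ new (D⊆T _ _ old))) , proj₂ ]′ (DX-view h))
      }

  σ : Fin (suc n) → Fin n
  σ a with a ≟ j
  ... | yes _   = i′
  ... | no  a≢j = proj₁ (ι-onto a≢j)

  σ-ι : ∀ u → σ (ι u) ≡ u
  σ-ι u with ι u ≟ j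
  ... | yes u≡j = ⊥-elim (ι≢j u u≡j)
  ... | no  u≢j = ι-injective (proj₂ (ι-onto u≢j))

  σ-j : σ j ≡ i′
  σ-j with j ≟ j
  ... | yes _   = refl
  ... | no  j≢j = ⊥-elim (j≢j refl)

  σ-i : σ i ≡ i′
  σ-i = trans (cong σ (sym ι-i′)) (σ-ι i′)

  opposite : Fin (suc n) → Fin n
  opposite b with b ≟ i
  ... | yes _ = k′
  ... | no  _ = i′

  opposite-NewEdge : ∀ {u v} → NewEdge u v → opposite (ι v) ≡ u
  opposite-NewEdge {v = v} new with ι v ≟ i | new
  ... | yes v≡i | inj₁ (_ , v≡k)   = ⊥-elim (i≢k (trans (sym v≡i) v≡k))
  ... | yes _   | inj₂ (u≡k , _)   = ι-injective (trans ι-k′ (sym u≡k))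
  ... | no  _   | inj₁ (u≡i , _)   = ι-injective (trans ι-i′ (sym u≡i))
  ... | no  v≢i | inj₂ (_ , v≡i)   = ⊥-elim (v≢i v≡i)

  -- A vertex a of T as seen from its neighbour b: j is merged with the endpoint of i – k
  -- opposite to b.
  image : Fin (suc n) → Fin (suc n) → Fin n
  image a b with a ≟ j
  ... | yes _ = opposite b
  ... | no  _ = σ a

  image-ι : ∀ u b → image (ι u) b ≡ u
  image-ι u b with ι u ≟ j
  ... | yes u≡j = ⊥-elim (ι≢j u u≡j)
  ... | no  _   = σ-ι u

  image-j : ∀ b → image j b ≡ opposite b
  image-j b with j ≟ j
  ... | yes _   = refl
  ... | no  j≢j = ⊥-elim (j≢j refl)

  module Expand {DX : Fin n → Fin n → Bool} (admissible : Admissible adjX JX DX) where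

    DX⊆X : ArcsAreEdges X DX
    DX⊆X = proj₁ (proj₁ admissible)

    DX-total : ∀ u v → u ~ˣ v → Arc DX u v ⊎ Arc DX v u
    DX-total = proj₁ (proj₂ (proj₁ admissible))

    DX-acyclic : ∀ v → ¬ TransClosure (Arc DX) v v
    DX-acyclic = proj₂ (proj₂ (proj₁ admissible))

    DX-asym : ∀ {u v} → Arc DX u v → Arc DX v u → ⊥
    DX-asym {u} uv vu = DX-acyclic u (uv ∷ ⟪ vu ⟫)

    D : Fin (suc n) → Fin (suc n) → Bool
    D a b = adjT a b ∧ DX (image a b) (image b a)

    D⊆T : ArcsAreEdges tree D
    D⊆T a b h = proj₁ (to T-∧ h)

    arc-via-image : ∀ {a b u v} → a ~ b → image a b ≡ u → image b a ≡ v → Arc D a b ⇔ Arc DX u v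
    arc-via-image {a} {b} a~b refl refl = mk⇔ (proj₂ ∘ to (T-∧ {adjT a b})) (λ h → from T-∧ (a~b , h))

    old-arc : ∀ {u v} → ι u ~ ι v → Arc D (ι u) (ι v) ⇔ Arc DX u v
    old-arc {u} {v} u~v = arc-via-image u~v (image-ι u (ι v)) (image-ι v (ι u))

    arc-out-of-j : ∀ {u v} → NewEdge u v → Arc D j (ι v) ⇔ Arc DX u v
    arc-out-of-j {v = v} new = arc-via-image (~-sym (NewEdge⇒~j (NewEdge-sym new)))
      (trans (image-j (ι v)) (opposite-NewEdge new)) (image-ι v j)

    arc-into-j : ∀ {u v} → NewEdge u v → Arc D (ι u) j ⇔ Arc DX u v
    arc-into-j {u} new = arc-via-image (NewEdge⇒~j new)
      (image-ι u j) (trans (image-j (ι u)) (opposite-NewEdge (NewEdge-sym new)))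

    D-total : ∀ a b → a ~ b → Arc D a b ⊎ Arc D b a
    D-total a b a~b with j ≟ a | j ≟ b
    ... | yes refl | yes refl = ⊥-elim (adj-irr tree j a~b)
    ... | yes refl | no  j≢b
      with v , refl ← ι-onto (j≢b ∘ sym)
      with f , new  ← other-endpoint (~-sym a~b) =
      Sum.map (from (arc-out-of-j (NewEdge-sym new))) (from (arc-into-j new))
        (DX-total f v (~ˣ-new (NewEdge-sym new)))
    ... | no  j≢a  | yes refl
      with u , refl ← ι-onto (j≢a ∘ sym)
      with f , new  ← other-endpoint a~b =
      Sum.map (from (arc-into-j new)) (from (arc-out-of-j (NewEdge-sym new)))
        (DX-total u f (~ˣ-new new))
    ... | no  j≢a  | no  j≢b
      with u , refl ← ι-onto (j≢a ∘ sym) | v , refl ← ι-onto (j≢b ∘ sym) =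
      Sum.map (from (old-arc a~b)) (from (old-arc (~-sym a~b))) (DX-total u v (~ˣ-old a~b))

    -- Collapsing j onto i turns every arc of D into an arc of DX, except an arc between i and j.
    Collapsed : Fin (suc n) → Fin (suc n) → Set
    Collapsed a b = (a ≡ i × b ≡ j × Arc DX i′ k′) ⊎ (a ≡ j × b ≡ i × Arc DX k′ i′)

    σ-collapsed : ∀ {a b} → Collapsed a b → σ a ≡ σ b
    σ-collapsed (inj₁ (refl , refl , _)) = trans σ-i (sym σ-j)
    σ-collapsed (inj₂ (refl , refl , _)) = trans σ-j (sym σ-i)

    ¬collapsed-twice : ∀ {a b c} → Collapsed a b → Collapsed b c → ⊥
    ¬collapsed-twice (inj₁ (_ , refl , ik)) (inj₂ (_ , _ , ki))    = DX-asym ik ki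
    ¬collapsed-twice (inj₂ (_ , refl , ki)) (inj₁ (_ , _ , ik))    = DX-asym ik ki
    ¬collapsed-twice (inj₁ (_ , refl , _))  (inj₁ (j≡i , _ , _))   = i≢j (sym j≡i)
    ¬collapsed-twice (inj₂ (_ , refl , _))  (inj₂ (i≡j , _ , _))   = i≢j i≡j

    arc-σ-out-of-j : ∀ v → Arc D j (ι v) → Arc DX (σ j) (σ (ι v)) ⊎ Collapsed j (ι v)
    arc-σ-out-of-j v jv with N[j]⊆ik (~-sym (D⊆T _ _ jv))
    ... | inj₁ v≡i = inj₂ (inj₂ (refl , v≡i ,
            subst (Arc DX k′) (ι-injective (trans v≡i (sym ι-i′))) (to (arc-out-of-j (inj₂ (ι-k′ , v≡i))) jv)))
    ... | inj₂ v≡k = inj₁ (subst₂ (Arc DX) (sym σ-j) (sym (σ-ι v)) (to (arc-out-of-j (inj₁ (ι-i′ , v≡k))) jv))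

    arc-σ-into-j : ∀ u → Arc D (ι u) j → Arc DX (σ (ι u)) (σ j) ⊎ Collapsed (ι u) j
    arc-σ-into-j u uj with N[j]⊆ik (D⊆T _ _ uj)
    ... | inj₁ u≡i = inj₂ (inj₁ (u≡i , refl ,
            subst (λ w → Arc DX w k′) (ι-injective (trans u≡i (sym ι-i′))) (to (arc-into-j (inj₁ (u≡i , ι-k′))) uj)))
    ... | inj₂ u≡k = inj₁ (subst₂ (Arc DX) (sym (σ-ι u)) (sym σ-j) (to (arc-into-j (inj₂ (u≡k , ι-i′))) uj))

    arc-σ : ∀ {a b} → Arc D a b → Arc DX (σ a) (σ b) ⊎ Collapsed a b
    arc-σ {a} {b} ab with j ≟ a | j ≟ b
    ... | yes refl | yes refl = ⊥-elim (adj-irr tree j (D⊆T j j ab))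
    ... | yes refl | no  j≢b with v , refl ← ι-onto (j≢b ∘ sym) = arc-σ-out-of-j v ab
    ... | no  j≢a  | yes refl with u , refl ← ι-onto (j≢a ∘ sym) = arc-σ-into-j u ab
    ... | no  j≢a  | no  j≢b with u , refl ← ι-onto (j≢a ∘ sym) | v , refl ← ι-onto (j≢b ∘ sym) =
      inj₁ (subst₂ (Arc DX) (sym (σ-ι u)) (sym (σ-ι v)) (to (old-arc (D⊆T _ _ ab)) ab))

    path-σ : ∀ {a b} → TransClosure (Arc D) a b → TransClosure (Arc DX) (σ a) (σ b) ⊎ Collapsed a b
    path-σ ⟪ ab ⟫ = Sum.map₁ ⟪_⟫ (arc-σ ab)
    path-σ {a} {b} (ac ∷ cb) with arc-σ ac | path-σ cb
    ... | inj₁ ac′ | inj₁ cb′ = inj₁ (ac′ ∷ cb′)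
    ... | inj₁ ac′ | inj₂ col = inj₁ ⟪ subst (Arc DX (σ a)) (σ-collapsed col) ac′ ⟫
    ... | inj₂ col | inj₁ cb′ = inj₁ (subst (λ w → TransClosure (Arc DX) w (σ b)) (sym (σ-collapsed col)) cb′)
    ... | inj₂ col | inj₂ col′ = ⊥-elim (¬collapsed-twice col col′)

    D-acyclic : ∀ v → ¬ TransClosure (Arc D) v v
    D-acyclic v cycle with path-σ cycle
    ... | inj₁ cycle′                   = DX-acyclic (σ v) cycle′
    ... | inj₂ (inj₁ (refl , i≡j , _)) = i≢j i≡j
    ... | inj₂ (inj₂ (refl , j≡i , _)) = i≢j (sym j≡i)

    D-J-at-j : ∀ a b → a ≢ b → a ~ j → b ~ j → (Arc D a j × Arc D j b) ⊎ (Arc D b j × Arc D j a)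
    D-J-at-j a b a≢b a~j b~j with a′ , refl ← ι-onto (~⇒≢ a~j) | b′ , refl ← ι-onto (~⇒≢ b~j)
      with new ← neighbours-of-j⇒NewEdge (a≢b ∘ cong ι) a~j b~j =
      Sum.map (λ h → from (arc-into-j new) h , from (arc-out-of-j new) h)
                   (λ h → from (arc-into-j (NewEdge-sym new)) h , from (arc-out-of-j (NewEdge-sym new)) h)
        (DX-total a′ b′ (~ˣ-new new))

    D-J : ∀ w → w ∈ J → ∀ a b → a ≢ b → a ~ w → b ~ w → (Arc D a w × Arc D w b) ⊎ (Arc D b w × Arc D w a)
    D-J w w∈J a b a≢b a~w b~w with j ≟ w
    ... | yes refl = D-J-at-j a b a≢b a~w b~w
    ... | no  j≢w
      with w′ , refl ← ι-onto (j≢w ∘ sym)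
         | a′ , refl ← ι-onto (J-neighbour≢j w∈J a~w)
         | b′ , refl ← ι-onto (J-neighbour≢j w∈J b~w) =
      Sum.map (Product.map (from (old-arc a~w)) (from (old-arc (~-sym b~w))))
                   (Product.map (from (old-arc b~w)) (from (old-arc (~-sym a~w))))
        (proj₂ admissible w′ (∈J-ι⁻ w∈J) a′ b′ (a≢b ∘ cong ι) (~ˣ-old a~w) (~ˣ-old b~w))

    D-admissible : Admissible adjT J D
    D-admissible = (D⊆T , D-total , D-acyclic) , D-J

    compatible : Compatible D DX
    compatible = record
      { D⊆T     = D⊆T
      ; DX⊆X    = DX⊆X
      ; old-arc = old-arc
      ; new-arc = arc-out-of-j
      }

  open Relabelling Kept′ R public

  contract-vertex : ∀ c → Vertex adjT I J c → ∃ λ cX → Vertex adjX IX JX cX × Agrees c cX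
  contract-vertex c (D , admissible , c-imset) =
    imset IX JX DX , imset-vertex DX-admissible ,
    λ A kept → imset-cong c-imset (imset-isImset IX JX DX) (CCond-relabel compatible A kept)
    where open Contract admissible

  expand-vertex : ∀ cX → Vertex adjX IX JX cX → ∃ λ c → Vertex adjT I J c × Agrees c cX
  expand-vertex cX (DX , admissible , cX-imset) =
    imset I J D , imset-vertex D-admissible ,
    λ A kept → imset-cong (imset-isImset I J D) cX-imset (CCond-relabel compatible A kept)
    where open Expand admissible

proposition7p2 : ∀ {n} (G : GluingTree (suc n)) (j i k : Fin (suc n)) →
    j ∈ GluingTree.J G → Nbhd2 (GluingTree.tree G) j i k →
    let adjT = adj (GluingTree.tree G)
        I = GluingTree.I G
        J = GluingTree.J G
        adjX = Xadj adjT j i k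
        IX = removeAt I j
        JX = removeAt J j
    in (∀ (x : Sub (suc n) → ℚ) → InCIM adjT I J x → ∀ (y : Sub n → ℚ) →
          (∀ A → Kept adjT I J j i k A → y (relabel j i k A) ≡ x A) →
          InCIM adjX IX JX y)
     × (∀ (y : Sub n → ℚ) → InCIM adjX IX JX y →
          Σ (Sub (suc n) → ℚ) λ x → InCIM adjT I J x
            × (∀ A → Kept adjT I J j i k A → y (relabel j i k A) ≡ x A))
proposition7p2 G j i k j∈J N[j] =
  (λ x x∈CIM y x~y → hull-push relabel-onto (λ A → proj₁) contract-vertex x∈CIM x~y) ,
  (λ y y∈CIM → hull-pull relabel-coord expand-vertex y∈CIM)
  where open Contraction G j i k j∈J N[j]
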